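{- In $\operatorname{PG}(2,29)$ there exist a $(507,19)$-arc, a $(534,20)$-arc, a $(565,21)$-arc, a $(595,22)$-arc, a $(628,23)$-arc and a $(695,25)$-arc; consequently $m_{19}(2,29)\ge 507$, $m_{20}(2,29)\ge 534$, $m_{21}(2,29)\ge 565$, $m_{22}(2,29)\ge 595$, $m_{23}(2,29)\ge 628$ and $m_{25}(2,29)\ge 695$.
   Context: $\operatorname{PG}(2,q)$ denotes the projective plane over the finite field $\operatorname{GF}(q)$, whose points and lines are the 1- and 2-dimensional subspaces of $\operatorname{GF}(q)^3$. An $(n,r)$-arc in $\operatorname{PG}(2,q)$ is a set $\mathcal{B}$ of $n$ points of $\operatorname{PG}(2,q)$ such that every line of $\operatorname{PG}(2,q)$ contains at most $r$ points of $\mathcal{B}$ and at least one line contains exactly $r$ points of $\mathcal{B}$. $m_r(2,q)$ denotes the maximum $n$ such that an $(n,r)$-arc in $\operatorname{PG}(2,q)$ exists. -}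

module Defs where

open import Data.Nat using (ℕ; NonZero; _≥_)
import Data.Nat as ℕ
open import Data.Nat.DivMod using (_mod_)
open import Data.Nat.Primality using (Prime)
open import Data.Fin using (Fin; toℕ; zero)
open import Data.Fin.Properties using (_≟_)
open import Data.Product using (Σ; ∃; _×_; _,_)
open import Data.List using (List; length; filter)
open import Data.List.Relation.Unary.AllPairs using (AllPairs)
open import Relation.Binary.PropositionalEquality using (_≡_)
open import Relation.Nullary using (¬_)

module GF (q : ℕ) .{{_ : NonZero q}} where

  F : Set
  F = Fin q

  _+F_ : F → F → F
  a +F b = (toℕ a ℕ.+ toℕ b) mod q

  _*F_ : F → F → F
  a *F b = (toℕ a ℕ.* toℕ b) mod q

  0F : F
  0F = (0 mod q)

  V3 : Set
  V3 = F × F × F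

  0V : V3
  0V = (0F , 0F , 0F)

  _·_ : F → V3 → V3
  c · (x , y , z) = (c *F x , c *F y , c *F z)

  -- a point of PG(2,q): the 1-dimensional subspace spanned by a nonzero vector
  record Point : Set where
    constructor pt
    field
      vec     : V3
      nonzero : ¬ (vec ≡ 0V)
  open Point public

  SamePoint : Point → Point → Set
  SamePoint P Q = Σ F λ c → vec Q ≡ c · vec P

  -- a line of PG(2,q): the 2-dimensional subspace {v | a₀v₀+a₁v₁+a₂v₂ = 0}
  -- given by a nonzero coefficient vector (every 2-dim subspace is of this form)
  Line : Set
  Line = Point

  dot : V3 → V3 → F
  dot (a , b , c) (x , y , z) = ((a *F x) +F (b *F y)) +F (c *F z)

  _on_ : (P : Point) (L : Line) → Set
  P on L = dot (vec L) (vec P) ≡ 0F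

  count : Line → List Point → ℕ
  count L B = length (filter (λ P → dot (vec L) (vec P) ≟ 0F) B)

  IsArc : ℕ → ℕ → List Point → Set
  IsArc n r B =
      length B ≡ n
    × AllPairs (λ P Q → ¬ SamePoint P Q) B
    × (∀ (L : Line) → count L B ℕ.≤ r)
    × ∃ (λ (L : Line) → count L B ≡ r)

  ArcExists : ℕ → ℕ → Set
  ArcExists n r = ∃ λ (B : List Point) → IsArc n r B

  -- m_r(2,q) ≥ n  (m_r(2,q) is the maximum size of an (·,r)-arc):
  -- there is an (n',r)-arc with n' ≥ n
  m≥ : ℕ → ℕ → Set
  m≥ r n = ∃ λ n' → n' ≥ n × ArcExists n' r

-- Every line of PG(2,q) is a nonzero multiple of a line in normal form (1:b:c), (0:1:c)
-- or (0:0:1), and scaling a line does not change which points lie on it; so a point set meets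
-- every line in at most r points as soon as it does so for the q² + q + 1 normal lines, which is
-- checked by evaluation for the six explicit point sets of the paper.  The points are also given
-- in normal form, where proportional vectors are equal, so pairwise distinctness follows from a
-- strictly increasing numerical key along the list.
module Submission where

open import Defs
import Data.Nat as ℕ
open import Data.Nat using (ℕ; suc; _+_; _*_; _%_; _≤_; _<_; _≤?_; _<?_; NonZero; nonZero; >-nonZero⁻¹; s≤s; z≤n)
open import Data.Nat.Properties using (≤-refl; <-trans; <-irrefl; *-assoc; *-comm; *-identityˡ; *-zeroʳ)
open import Data.Nat.DivMod using (_mod_; %-distribˡ-+; %-distribˡ-*; m<n⇒m%n≡m)
open import Data.Nat.Tactic.RingSolver using (solve-∀)
open import Data.Fin using (toℕ)
open import Data.Fin.Properties using (_≟_; toℕ-fromℕ<; toℕ-injective; toℕ<n; all?; any?)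
open import Data.Product using (∃; _×_; _,_; proj₁; proj₂)
open import Data.Sum using (_⊎_; [_,_]′)
open import Data.Bool using (true; false)
open import Data.Empty using (⊥-elim)
open import Data.List using (List; []; _∷_; length; filter; map)
open import Data.List.Properties using (length-map; filter-≐)
open import Data.List.Relation.Unary.AllPairs as AllPairs using (AllPairs)
import Data.List.Relation.Unary.AllPairs.Properties as AllPairs
open import Data.List.Relation.Unary.Linked using (Linked; linked?)
open import Data.List.Relation.Unary.Linked.Properties using (Linked⇒AllPairs)
open import Function using (_∘_; id)
open import Relation.Binary.PropositionalEquality
open import Relation.Nullary using (¬_; Dec; yes; no; does)
open import Relation.Nullary.Decidable using (True; toWitness; _×-dec_; _⊎-dec_)
open import Relation.Unary using (Pred; Decidable)

length-filter-map : ∀ {a b p} {A : Set a} {B : Set b} {P : Pred B p} (P? : Decidable P) (f : A → B) xs →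
                    length (filter P? (map f xs)) ≡ length (filter (P? ∘ f) xs)
length-filter-map P? f [] = refl
length-filter-map P? f (x ∷ xs) with does (P? (f x))
... | true  = cong suc (length-filter-map P? f xs)
... | false = length-filter-map P? f xs

module _ {q : ℕ} .{{_ : NonZero q}} where
  open GF q

  arc⇒m≥ : ∀ {n r} → ArcExists n r → m≥ r n
  arc⇒m≥ {n} arc = n , ≤-refl , arc

-- _mod q : ℕ → Fin q is a surjective semiring homomorphism, so the laws of _+F_ and _*F_
-- are transported from ℕ.
module Residues (q : ℕ) .{{_ : NonZero q}} where
  open GF q

  1F : F
  1F = 1 mod q

  toℕ-mod : ∀ m → toℕ (m mod q) ≡ m % q
  toℕ-mod m = toℕ-fromℕ< _

  mod-cong : ∀ {m n} → m % q ≡ n % q → m mod q ≡ n mod q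
  mod-cong {m} {n} eq = toℕ-injective (trans (toℕ-mod m) (trans eq (sym (toℕ-mod n))))

  mod-toℕ : ∀ (a : F) → toℕ a mod q ≡ a
  mod-toℕ a = toℕ-injective (trans (toℕ-mod (toℕ a)) (m<n⇒m%n≡m (toℕ<n a)))

  0%q≡0 : 0 % q ≡ 0
  0%q≡0 = m<n⇒m%n≡m (>-nonZero⁻¹ q)

  mod≡0F⇒%≡0 : ∀ {n} → n mod q ≡ 0F → n % q ≡ 0
  mod≡0F⇒%≡0 {n} eq = trans (sym (toℕ-mod n)) (trans (cong toℕ eq) (trans (toℕ-mod 0) 0%q≡0))

  %≡0⇒mod≡0F : ∀ {n} → n % q ≡ 0 → n mod q ≡ 0F
  %≡0⇒mod≡0F eq = mod-cong (trans eq (sym 0%q≡0))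

  +F-mod : ∀ m n → (m mod q) +F (n mod q) ≡ (m + n) mod q
  +F-mod m n = mod-cong (begin
    (toℕ (m mod q) + toℕ (n mod q)) % q  ≡⟨ cong₂ (λ x y → (x + y) % q) (toℕ-mod m) (toℕ-mod n) ⟩
    (m % q + n % q) % q                  ≡⟨ %-distribˡ-+ m n q ⟨
    (m + n) % q                          ∎)
    where open ≡-Reasoning

  *F-mod : ∀ m n → (m mod q) *F (n mod q) ≡ (m * n) mod q
  *F-mod m n = mod-cong (begin
    (toℕ (m mod q) * toℕ (n mod q)) % q  ≡⟨ cong₂ (λ x y → (x * y) % q) (toℕ-mod m) (toℕ-mod n) ⟩
    (m % q * (n % q)) % q                ≡⟨ %-distribˡ-* m n q ⟨
    (m * n) % q                          ∎)
    where open ≡-Reasoning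

  *F-comm : ∀ a b → a *F b ≡ b *F a
  *F-comm a b = cong (_mod q) (*-comm (toℕ a) (toℕ b))

  *F-assoc : ∀ a b c → (a *F b) *F c ≡ a *F (b *F c)
  *F-assoc a b c = begin
    (a *F b) *F c                  ≡⟨ cong ((a *F b) *F_) (mod-toℕ c) ⟨
    ((A * B) mod q) *F (C mod q)   ≡⟨ *F-mod (A * B) C ⟩
    (A * B * C) mod q              ≡⟨ cong (_mod q) (*-assoc A B C) ⟩
    (A * (B * C)) mod q            ≡⟨ *F-mod A (B * C) ⟨
    (A mod q) *F ((B * C) mod q)   ≡⟨ cong (_*F (b *F c)) (mod-toℕ a) ⟩
    a *F (b *F c)                  ∎
    where
    open ≡-Reasoning
    A = toℕ a ; B = toℕ b ; C = toℕ c

  *F-identityˡ : ∀ a → 1F *F a ≡ a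
  *F-identityˡ a = begin
    1F *F a               ≡⟨ cong (1F *F_) (mod-toℕ a) ⟨
    1F *F (toℕ a mod q)   ≡⟨ *F-mod 1 (toℕ a) ⟩
    (1 * toℕ a) mod q     ≡⟨ cong (_mod q) (*-identityˡ (toℕ a)) ⟩
    toℕ a mod q           ≡⟨ mod-toℕ a ⟩
    a                     ∎
    where open ≡-Reasoning

  *F-identityʳ : ∀ a → a *F 1F ≡ a
  *F-identityʳ a = trans (*F-comm a 1F) (*F-identityˡ a)

  *F-zeroʳ : ∀ a → a *F 0F ≡ 0F
  *F-zeroʳ a = begin
    a *F 0F               ≡⟨ cong (_*F 0F) (mod-toℕ a) ⟨
    (toℕ a mod q) *F 0F   ≡⟨ *F-mod (toℕ a) 0 ⟩
    (toℕ a * 0) mod q     ≡⟨ cong (_mod q) (*-zeroʳ (toℕ a)) ⟩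
    0F                    ∎
    where open ≡-Reasoning

  *F-zeroˡ : ∀ a → 0F *F a ≡ 0F
  *F-zeroˡ a = trans (*F-comm 0F a) (*F-zeroʳ a)

  ℕ³ : Set
  ℕ³ = ℕ × ℕ × ℕ

  embed : ℕ³ → V3
  embed (x , y , z) = (x mod q , y mod q , z mod q)

  toℕ³ : V3 → ℕ³
  toℕ³ (x , y , z) = (toℕ x , toℕ y , toℕ z)

  embed-toℕ³ : ∀ v → embed (toℕ³ v) ≡ v
  embed-toℕ³ (x , y , z) = cong₂ _,_ (mod-toℕ x) (cong₂ _,_ (mod-toℕ y) (mod-toℕ z))

  rawDot : ℕ³ → ℕ³ → ℕ
  rawDot (a , b , c) (x , y , z) = a * x + b * y + c * z

  rawDot-scale : ∀ k x y z v → rawDot (k * x , k * y , k * z) v ≡ k * rawDot (x , y , z) v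
  rawDot-scale k x y z (a , b , c) = scale k x y z a b c
    where
    scale : ∀ k x y z a b c → k * x * a + k * y * b + k * z * c ≡ k * (x * a + y * b + z * c)
    scale = solve-∀

  dot-embed : ∀ u v → dot (embed u) (embed v) ≡ rawDot u v mod q
  dot-embed (a , b , c) (x , y , z) = begin
    ((a′ *F x′) +F (b′ *F y′)) +F (c′ *F z′)
      ≡⟨ cong₂ _+F_ (cong₂ _+F_ (*F-mod a x) (*F-mod b y)) (*F-mod c z) ⟩
    (((a * x) mod q) +F ((b * y) mod q)) +F ((c * z) mod q)
      ≡⟨ cong (_+F ((c * z) mod q)) (+F-mod (a * x) (b * y)) ⟩
    ((a * x + b * y) mod q) +F ((c * z) mod q)
      ≡⟨ +F-mod (a * x + b * y) (c * z) ⟩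
    (a * x + b * y + c * z) mod q
      ∎
    where
    open ≡-Reasoning
    a′ = a mod q ; b′ = b mod q ; c′ = c mod q
    x′ = x mod q ; y′ = y mod q ; z′ = z mod q

  dot-embedʳ : ∀ v w → dot v (embed w) ≡ rawDot (toℕ³ v) w mod q
  dot-embedʳ v w = trans (cong (λ u → dot u (embed w)) (sym (embed-toℕ³ v))) (dot-embed (toℕ³ v) w)

  dot-· : ∀ k u v → dot (k · u) v ≡ k *F dot u v
  dot-· k u@(x , y , z) v = begin
    dot (embed (K * X , K * Y , K * Z)) v          ≡⟨ cong (dot (k · u)) (embed-toℕ³ v) ⟨
    dot (embed (K * X , K * Y , K * Z)) (embed V)  ≡⟨ dot-embed (K * X , K * Y , K * Z) V ⟩
    rawDot (K * X , K * Y , K * Z) V mod q         ≡⟨ cong (_mod q) (rawDot-scale K X Y Z V) ⟩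
    (K * rawDot (X , Y , Z) V) mod q               ≡⟨ *F-mod K (rawDot (X , Y , Z) V) ⟨
    (K mod q) *F (rawDot (X , Y , Z) V mod q)      ≡⟨ cong₂ _*F_ (mod-toℕ k) (sym (dot-embedʳ u V)) ⟩
    k *F dot u (embed V)                           ≡⟨ cong (λ w → k *F dot u w) (embed-toℕ³ v) ⟩
    k *F dot u v                                   ∎
    where
    open ≡-Reasoning
    K = toℕ k ; X = toℕ x ; Y = toℕ y ; Z = toℕ z ; V = toℕ³ v

module Plane (q : ℕ) .{{_ : NonZero q}} (1<q : 1 < q) where
  open GF q
  open Residues q

  1F≢0F : 1F ≢ 0F
  1F≢0F 1F≡0F = 1≢0 (begin
    1        ≡⟨ m<n⇒m%n≡m 1<q ⟨
    1 % q    ≡⟨ toℕ-mod 1 ⟨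
    toℕ 1F   ≡⟨ cong toℕ 1F≡0F ⟩
    toℕ 0F   ≡⟨ toℕ-mod 0 ⟩
    0 % q    ≡⟨ 0%q≡0 ⟩
    0        ∎)
    where
    open ≡-Reasoning
    1≢0 : 1 ≢ 0
    1≢0 ()

  Invertible : F → Set
  Invertible k = ∃ λ j → j *F k ≡ 1F

  invertible-inverse : ∀ {k a} → k *F a ≡ 1F → Invertible k
  invertible-inverse {k} {a} ka≡1 = a , trans (*F-comm a k) ka≡1

  invertible-cancel : ∀ {k x} → Invertible k → k *F x ≡ 0F → x ≡ 0F
  invertible-cancel {k} {x} (j , jk≡1) kx≡0 = begin
    x               ≡⟨ *F-identityˡ x ⟨
    1F *F x         ≡⟨ cong (_*F x) jk≡1 ⟨
    (j *F k) *F x   ≡⟨ *F-assoc j k x ⟩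
    j *F (k *F x)   ≡⟨ cong (j *F_) kx≡0 ⟩
    j *F 0F         ≡⟨ *F-zeroʳ j ⟩
    0F              ∎
    where open ≡-Reasoning

  zeroOrInvertible? : Dec (∀ a → a ≡ 0F ⊎ Invertible a)
  zeroOrInvertible? = all? λ a → a ≟ 0F ⊎-dec any? λ j → j *F a ≟ 1F

  ·-identityˡ : ∀ v → 1F · v ≡ v
  ·-identityˡ (x , y , z) = cong₂ _,_ (*F-identityˡ x) (cong₂ _,_ (*F-identityˡ y) (*F-identityˡ z))

  countVec : V3 → List Point → ℕ
  countVec v B = length (filter (λ P → dot v (vec P) ≟ 0F) B)

  countVec-· : ∀ {k} → Invertible k → ∀ v B → countVec (k · v) B ≡ countVec v B
  countVec-· {k} k-inv v B =
    cong length (filter-≐ (λ P → dot (k · v) (vec P) ≟ 0F) (λ P → dot v (vec P) ≟ 0F)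
                          ((λ {P} → on-k·v⇒on-v P) , λ {P} → on-v⇒on-k·v P) B)
    where
    on-k·v⇒on-v : ∀ P → dot (k · v) (vec P) ≡ 0F → dot v (vec P) ≡ 0F
    on-k·v⇒on-v P eq = invertible-cancel k-inv (trans (sym (dot-· k v (vec P))) eq)
    on-v⇒on-k·v : ∀ P → dot v (vec P) ≡ 0F → dot (k · v) (vec P) ≡ 0F
    on-v⇒on-k·v P eq = trans (dot-· k v (vec P)) (trans (cong (k *F_) eq) (*F-zeroʳ k))

  data Normal : V3 → Set where
    pivot₀ : ∀ b c → Normal (1F , b , c)
    pivot₁ : ∀ c → Normal (0F , 1F , c)
    pivot₂ : Normal (0F , 0F , 1F)

  Normal⇒≢0V : ∀ {v} → Normal v → v ≢ 0V
  Normal⇒≢0V (pivot₀ b c) eq = 1F≢0F (cong proj₁ eq)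
  Normal⇒≢0V (pivot₁ c)   eq = 1F≢0F (cong (proj₁ ∘ proj₂) eq)
  Normal⇒≢0V pivot₂       eq = 1F≢0F (cong (proj₂ ∘ proj₂) eq)

  module _ (c : F) where

    1F≢c*0F : 1F ≢ c *F 0F
    1F≢c*0F eq = 1F≢0F (trans eq (*F-zeroʳ c))

    0F≡c*1F⇒1F≢c* : 0F ≡ c *F 1F → ∀ {x} → 1F ≢ c *F x
    0F≡c*1F⇒1F≢c* c≡0 {x} eq = 1F≢0F (begin
      1F        ≡⟨ eq ⟩
      c *F x    ≡⟨ cong (_*F x) (trans (sym (*F-identityʳ c)) (sym c≡0)) ⟩
      0F *F x   ≡⟨ *F-zeroˡ x ⟩
      0F        ∎)
      where open ≡-Reasoning

    1F≡c*1F⇒c·u≡u : ∀ u → 1F ≡ c *F 1F → c · u ≡ u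
    1F≡c*1F⇒c·u≡u u c≡1 = trans (cong (_· u) (trans (sym (*F-identityʳ c)) (sym c≡1))) (·-identityˡ u)

  Normal-unique : ∀ {u v} → Normal u → Normal v → ∀ c → v ≡ c · u → v ≡ u
  Normal-unique {u} (pivot₀ _ _) (pivot₀ _ _) c eq = trans eq (1F≡c*1F⇒c·u≡u c u (cong proj₁ eq))
  Normal-unique {u} (pivot₁ _)   (pivot₁ _)   c eq = trans eq (1F≡c*1F⇒c·u≡u c u (cong (proj₁ ∘ proj₂) eq))
  Normal-unique {u} pivot₂       pivot₂       c eq = trans eq (1F≡c*1F⇒c·u≡u c u (cong (proj₂ ∘ proj₂) eq))
  Normal-unique (pivot₁ _)   (pivot₀ _ _) c eq = ⊥-elim (1F≢c*0F c (cong proj₁ eq))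
  Normal-unique pivot₂       (pivot₀ _ _) c eq = ⊥-elim (1F≢c*0F c (cong proj₁ eq))
  Normal-unique pivot₂       (pivot₁ _)   c eq = ⊥-elim (1F≢c*0F c (cong (proj₁ ∘ proj₂) eq))
  Normal-unique (pivot₀ _ _) (pivot₁ _)   c eq =
    ⊥-elim (0F≡c*1F⇒1F≢c* c (cong proj₁ eq) (cong (proj₁ ∘ proj₂) eq))
  Normal-unique (pivot₀ _ _) pivot₂       c eq =
    ⊥-elim (0F≡c*1F⇒1F≢c* c (cong proj₁ eq) (cong (proj₂ ∘ proj₂) eq))
  Normal-unique (pivot₁ _)   pivot₂       c eq =
    ⊥-elim (0F≡c*1F⇒1F≢c* c (cong (proj₁ ∘ proj₂) eq) (cong (proj₂ ∘ proj₂) eq))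

  AllNormal : (V3 → Set) → Set
  AllNormal P = (∀ b c → P (1F , b , c)) × (∀ c → P (0F , 1F , c)) × P (0F , 0F , 1F)

  allNormal? : ∀ {P : V3 → Set} → Decidable P → Dec (AllNormal P)
  allNormal? P? = all? (λ b → all? λ c → P? _) ×-dec all? (λ c → P? _) ×-dec P? _

  AllNormal-lookup : ∀ {P v} → AllNormal P → Normal v → P v
  AllNormal-lookup (all₀ , all₁ , all₂) (pivot₀ b c) = all₀ b c
  AllNormal-lookup (all₀ , all₁ , all₂) (pivot₁ c)   = all₁ c
  AllNormal-lookup (all₀ , all₁ , all₂) pivot₂       = all₂

  data Rep : Set where
    affine : ℕ → ℕ → Rep
    ideal  : ℕ → Rep
    ideal∞ : Rep

  coords : Rep → ℕ³
  coords (affine x y) = (1 , x , y)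
  coords (ideal y)    = (0 , 1 , y)
  coords ideal∞       = (0 , 0 , 1)

  Rep-normal : ∀ d → Normal (embed (coords d))
  Rep-normal (affine x y) = pivot₀ (x mod q) (y mod q)
  Rep-normal (ideal y)    = pivot₁ (y mod q)
  Rep-normal ideal∞       = pivot₂

  ⟦_⟧ : Rep → Point
  ⟦ d ⟧ = pt (embed (coords d)) (Normal⇒≢0V (Rep-normal d))

  key : V3 → ℕ
  key (x , y , z) = (toℕ x * q + toℕ y) * q + toℕ z

  KeyIncreasing : List Rep → Set
  KeyIncreasing = Linked (λ d d′ → key (vec ⟦ d ⟧) < key (vec ⟦ d′ ⟧))

  keyIncreasing? : ∀ ds → Dec (KeyIncreasing ds)
  keyIncreasing? = linked? (λ d d′ → key (vec ⟦ d ⟧) <? key (vec ⟦ d′ ⟧))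

  KeyIncreasing⇒distinct : ∀ {ds} → KeyIncreasing ds → AllPairs (λ P Q → ¬ SamePoint P Q) (map ⟦_⟧ ds)
  KeyIncreasing⇒distinct {ds} increasing = AllPairs.map⁺ distinctReps
    where
    key<⇒distinct : ∀ d d′ → key (vec ⟦ d ⟧) < key (vec ⟦ d′ ⟧) → ¬ SamePoint ⟦ d ⟧ ⟦ d′ ⟧
    key<⇒distinct d d′ key< (c , d′≡c·d) =
      <-irrefl (cong key (sym (Normal-unique (Rep-normal d) (Rep-normal d′) c d′≡c·d))) key<

    distinctReps : AllPairs (λ d d′ → ¬ SamePoint ⟦ d ⟧ ⟦ d′ ⟧) ds
    distinctReps = AllPairs.map (λ {d} {d′} → key<⇒distinct d d′) (Linked⇒AllPairs <-trans increasing)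

  -- The same number as countVec, computed with builtin ℕ arithmetic: evaluating countVec through
  -- Fin arithmetic on all q² + q + 1 normal lines is far too slow.
  rawCount : ℕ³ → List Rep → ℕ
  rawCount u ds = length (filter (λ d → rawDot u (coords d) % q ℕ.≟ 0) ds)

  countVec-⟦⟧ : ∀ v ds → countVec v (map ⟦_⟧ ds) ≡ rawCount (toℕ³ v) ds
  countVec-⟦⟧ v ds = begin
    countVec v (map ⟦_⟧ ds)
      ≡⟨ length-filter-map (λ P → dot v (vec P) ≟ 0F) ⟦_⟧ ds ⟩
    length (filter (λ d → dot v (vec ⟦ d ⟧) ≟ 0F) ds)
      ≡⟨ cong length (filter-≐ _ _ ((λ {d} → raw≡0 d) , λ {d} → dot≡0 d) ds) ⟩
    rawCount (toℕ³ v) ds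
      ∎
    where
    open ≡-Reasoning
    raw≡0 : ∀ d → dot v (vec ⟦ d ⟧) ≡ 0F → rawDot (toℕ³ v) (coords d) % q ≡ 0
    raw≡0 d eq = mod≡0F⇒%≡0 (trans (sym (dot-embedʳ v (coords d))) eq)
    dot≡0 : ∀ d → rawDot (toℕ³ v) (coords d) % q ≡ 0 → dot v (vec ⟦ d ⟧) ≡ 0F
    dot≡0 d eq = trans (dot-embedʳ v (coords d)) (%≡0⇒mod≡0F eq)

  LinesBounded : ℕ → List Rep → Set
  LinesBounded r ds = AllNormal (λ v → rawCount (toℕ³ v) ds ≤ r)

  linesBounded? : ∀ r ds → Dec (LinesBounded r ds)
  linesBounded? r ds = allNormal? (λ v → rawCount (toℕ³ v) ds ≤? r)

  module _ (nonzero⇒invertible : ∀ a → a ≢ 0F → Invertible a) where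

    normalise : ∀ v → v ≢ 0V → ∃ λ k → Invertible k × Normal (k · v)
    normalise (a , b , c) v≢0 with a ≟ 0F | b ≟ 0F | c ≟ 0F
    ... | no a≢0 | _ | _ =
      let k , ka≡1 = nonzero⇒invertible a a≢0 in
      k , invertible-inverse ka≡1 , subst (λ t → Normal (t , k *F b , k *F c)) (sym ka≡1) (pivot₀ _ _)
    ... | yes refl | no b≢0 | _ =
      let k , kb≡1 = nonzero⇒invertible b b≢0 in
      k , invertible-inverse kb≡1 , subst₂ (λ s t → Normal (s , t , k *F c)) (sym (*F-zeroʳ k)) (sym kb≡1) (pivot₁ _)
    ... | yes refl | yes refl | no c≢0 =
      let k , kc≡1 = nonzero⇒invertible c c≢0 in
      k , invertible-inverse kc≡1 , subst₂ (λ s t → Normal (s , s , t)) (sym (*F-zeroʳ k)) (sym kc≡1) pivot₂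
    ... | yes refl | yes refl | yes refl = ⊥-elim (v≢0 refl)

    normal-count≤⇒count≤ : ∀ {r B} → (∀ {v} → Normal v → countVec v B ≤ r) → ∀ L → count L B ≤ r
    normal-count≤⇒count≤ {r} {B} bounded L with normalise (vec L) (nonzero L)
    ... | k , k-inv , kL-normal = subst (_≤ r) (countVec-· k-inv (vec L) B) (bounded kL-normal)

    arcOfReps : ∀ ds r → KeyIncreasing ds → LinesBounded r ds →
                (L : Line) → count L (map ⟦_⟧ ds) ≡ r → ArcExists (length ds) r
    arcOfReps ds r increasing bounded L tight =
        map ⟦_⟧ ds , length-map ⟦_⟧ ds , KeyIncreasing⇒distinct increasing
      , normal-count≤⇒count≤ {r} {map ⟦_⟧ ds} boundedOnNormal , L , tight
      where
      boundedOnNormal : ∀ {v} → Normal v → countVec v (map ⟦_⟧ ds) ≤ r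
      boundedOnNormal {v} nv =
        subst (_≤ r) (sym (countVec-⟦⟧ v ds)) (AllNormal-lookup {λ v → rawCount (toℕ³ v) ds ≤ r} bounded nv)

module PG[2,29] where
  open GF 29
  open Plane 29 (s≤s (s≤s z≤n))

  nonzero⇒invertible : ∀ a → a ≢ 0F → Invertible a
  nonzero⇒invertible a a≢0 = [ ⊥-elim ∘ a≢0 , id ]′ (toWitness {a? = zeroOrInvertible?} _ a)

  checkedArc : ∀ ds r → {True (keyIncreasing? ds)} → {True (linesBounded? r ds)} →
               (L : Line) → count L (map ⟦_⟧ ds) ≡ r → ArcExists (length ds) r
  checkedArc ds r {increasing} {bounded} =
    arcOfReps nonzero⇒invertible ds r (toWitness increasing) (toWitness bounded)

  points-507-19 : List Rep
  points-507-19 =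
    ideal 1 ∷ ideal 4 ∷ ideal 5 ∷ ideal 7 ∷ ideal 12 ∷ ideal 15 ∷ ideal 17 ∷ ideal 18 ∷ ideal 20 ∷
    ideal 22 ∷ ideal 23 ∷ ideal 24 ∷ ideal 25 ∷ ideal 26 ∷ ideal 28 ∷
    affine 1 0 ∷ affine 1 1 ∷ affine 1 2 ∷ affine 1 5 ∷ affine 1 6 ∷ affine 1 7 ∷ affine 1 8 ∷
    affine 1 9 ∷ affine 1 10 ∷ affine 1 11 ∷ affine 1 13 ∷ affine 1 15 ∷ affine 1 17 ∷ affine 1 20 ∷
    affine 1 22 ∷ affine 1 23 ∷ affine 1 24 ∷ affine 1 28 ∷
    affine 2 1 ∷ affine 2 2 ∷ affine 2 3 ∷ affine 2 5 ∷ affine 2 8 ∷ affine 2 9 ∷ affine 2 11 ∷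
    affine 2 13 ∷ affine 2 14 ∷ affine 2 15 ∷ affine 2 18 ∷ affine 2 19 ∷ affine 2 22 ∷
    affine 2 23 ∷ affine 2 24 ∷ affine 2 25 ∷ affine 2 27 ∷ affine 2 28 ∷
    affine 3 1 ∷ affine 3 3 ∷ affine 3 4 ∷ affine 3 5 ∷ affine 3 6 ∷ affine 3 8 ∷ affine 3 9 ∷
    affine 3 10 ∷ affine 3 11 ∷ affine 3 12 ∷ affine 3 13 ∷ affine 3 14 ∷ affine 3 17 ∷
    affine 3 18 ∷ affine 3 19 ∷ affine 3 21 ∷ affine 3 22 ∷ affine 3 23 ∷ affine 3 25 ∷
    affine 4 0 ∷ affine 4 1 ∷ affine 4 2 ∷ affine 4 3 ∷ affine 4 6 ∷ affine 4 8 ∷ affine 4 9 ∷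
    affine 4 10 ∷ affine 4 11 ∷ affine 4 12 ∷ affine 4 14 ∷ affine 4 16 ∷ affine 4 18 ∷
    affine 4 20 ∷ affine 4 21 ∷ affine 4 22 ∷ affine 4 24 ∷ affine 4 28 ∷
    affine 5 0 ∷ affine 5 3 ∷ affine 5 4 ∷ affine 5 7 ∷ affine 5 8 ∷ affine 5 9 ∷ affine 5 12 ∷
    affine 5 14 ∷ affine 5 21 ∷ affine 5 22 ∷ affine 5 23 ∷ affine 5 24 ∷ affine 5 25 ∷
    affine 6 0 ∷ affine 6 1 ∷ affine 6 5 ∷ affine 6 6 ∷ affine 6 7 ∷ affine 6 11 ∷ affine 6 12 ∷
    affine 6 13 ∷ affine 6 15 ∷ affine 6 16 ∷ affine 6 17 ∷ affine 6 19 ∷ affine 6 21 ∷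
    affine 6 22 ∷ affine 6 24 ∷ affine 6 25 ∷ affine 6 27 ∷ affine 6 28 ∷
    affine 7 0 ∷ affine 7 1 ∷ affine 7 3 ∷ affine 7 4 ∷ affine 7 6 ∷ affine 7 8 ∷ affine 7 9 ∷
    affine 7 12 ∷ affine 7 14 ∷ affine 7 15 ∷ affine 7 16 ∷ affine 7 17 ∷ affine 7 19 ∷
    affine 7 20 ∷ affine 7 21 ∷ affine 7 22 ∷ affine 7 25 ∷ affine 7 27 ∷ affine 7 28 ∷
    affine 8 1 ∷ affine 8 2 ∷ affine 8 4 ∷ affine 8 6 ∷ affine 8 8 ∷ affine 8 9 ∷ affine 8 11 ∷
    affine 8 13 ∷ affine 8 14 ∷ affine 8 15 ∷ affine 8 17 ∷ affine 8 18 ∷ affine 8 19 ∷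
    affine 8 20 ∷ affine 8 22 ∷ affine 8 23 ∷ affine 8 24 ∷ affine 8 25 ∷ affine 8 27 ∷
    affine 9 0 ∷ affine 9 1 ∷ affine 9 2 ∷ affine 9 4 ∷ affine 9 5 ∷ affine 9 6 ∷ affine 9 7 ∷
    affine 9 10 ∷ affine 9 11 ∷ affine 9 15 ∷ affine 9 19 ∷ affine 9 21 ∷ affine 9 22 ∷
    affine 9 23 ∷ affine 9 24 ∷ affine 9 25 ∷ affine 9 27 ∷ affine 9 28 ∷
    affine 10 5 ∷ affine 10 8 ∷ affine 10 10 ∷ affine 10 11 ∷ affine 10 12 ∷ affine 10 13 ∷
    affine 10 15 ∷ affine 10 18 ∷ affine 10 20 ∷ affine 10 22 ∷ affine 10 23 ∷ affine 10 25 ∷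
    affine 10 27 ∷
    affine 11 2 ∷ affine 11 3 ∷ affine 11 4 ∷ affine 11 6 ∷ affine 11 7 ∷ affine 11 8 ∷
    affine 11 10 ∷ affine 11 12 ∷ affine 11 13 ∷ affine 11 14 ∷ affine 11 15 ∷ affine 11 22 ∷
    affine 11 23 ∷ affine 11 24 ∷ affine 11 27 ∷
    affine 12 0 ∷ affine 12 2 ∷ affine 12 3 ∷ affine 12 4 ∷ affine 12 7 ∷ affine 12 8 ∷
    affine 12 9 ∷ affine 12 11 ∷ affine 12 14 ∷ affine 12 15 ∷ affine 12 16 ∷ affine 12 17 ∷
    affine 12 18 ∷ affine 12 19 ∷ affine 12 21 ∷ affine 12 23 ∷ affine 12 24 ∷ affine 12 25 ∷
    affine 12 28 ∷
    affine 13 0 ∷ affine 13 1 ∷ affine 13 2 ∷ affine 13 3 ∷ affine 13 4 ∷ affine 13 6 ∷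
    affine 13 7 ∷ affine 13 9 ∷ affine 13 10 ∷ affine 13 11 ∷ affine 13 12 ∷ affine 13 13 ∷
    affine 13 16 ∷ affine 13 17 ∷ affine 13 18 ∷ affine 13 23 ∷ affine 13 27 ∷ affine 13 28 ∷
    affine 14 2 ∷ affine 14 3 ∷ affine 14 4 ∷ affine 14 5 ∷ affine 14 6 ∷ affine 14 7 ∷
    affine 14 8 ∷ affine 14 10 ∷ affine 14 11 ∷ affine 14 12 ∷ affine 14 13 ∷ affine 14 15 ∷
    affine 14 16 ∷ affine 14 17 ∷ affine 14 19 ∷ affine 14 20 ∷ affine 14 21 ∷ affine 14 23 ∷
    affine 14 25 ∷
    affine 15 0 ∷ affine 15 1 ∷ affine 15 3 ∷ affine 15 4 ∷ affine 15 5 ∷ affine 15 6 ∷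
    affine 15 7 ∷ affine 15 9 ∷ affine 15 10 ∷ affine 15 12 ∷ affine 15 13 ∷ affine 15 15 ∷
    affine 15 16 ∷ affine 15 19 ∷ affine 15 21 ∷ affine 15 22 ∷ affine 15 24 ∷ affine 15 27 ∷
    affine 15 28 ∷
    affine 16 0 ∷ affine 16 1 ∷ affine 16 2 ∷ affine 16 6 ∷ affine 16 8 ∷ affine 16 9 ∷
    affine 16 11 ∷ affine 16 13 ∷ affine 16 15 ∷ affine 16 19 ∷ affine 16 20 ∷ affine 16 22 ∷
    affine 16 23 ∷ affine 16 25 ∷ affine 16 27 ∷
    affine 17 0 ∷ affine 17 3 ∷ affine 17 4 ∷ affine 17 5 ∷ affine 17 7 ∷ affine 17 9 ∷
    affine 17 10 ∷ affine 17 11 ∷ affine 17 12 ∷ affine 17 14 ∷ affine 17 15 ∷ affine 17 17 ∷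
    affine 17 18 ∷ affine 17 19 ∷ affine 17 21 ∷ affine 17 22 ∷ affine 17 23 ∷ affine 17 25 ∷
    affine 17 27 ∷
    affine 18 0 ∷ affine 18 1 ∷ affine 18 2 ∷ affine 18 4 ∷ affine 18 5 ∷ affine 18 8 ∷
    affine 18 9 ∷ affine 18 10 ∷ affine 18 13 ∷ affine 18 16 ∷ affine 18 17 ∷ affine 18 18 ∷
    affine 18 19 ∷ affine 18 20 ∷ affine 18 22 ∷ affine 18 24 ∷ affine 18 25 ∷ affine 18 28 ∷
    affine 19 0 ∷ affine 19 1 ∷ affine 19 4 ∷ affine 19 6 ∷ affine 19 7 ∷ affine 19 8 ∷
    affine 19 9 ∷ affine 19 10 ∷ affine 19 13 ∷ affine 19 16 ∷ affine 19 17 ∷ affine 19 19 ∷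
    affine 19 20 ∷ affine 19 21 ∷ affine 19 24 ∷ affine 19 25 ∷ affine 19 27 ∷ affine 19 28 ∷
    affine 20 1 ∷ affine 20 2 ∷ affine 20 4 ∷ affine 20 5 ∷ affine 20 6 ∷ affine 20 8 ∷
    affine 20 9 ∷ affine 20 11 ∷ affine 20 13 ∷ affine 20 14 ∷ affine 20 15 ∷ affine 20 16 ∷
    affine 20 20 ∷ affine 20 21 ∷ affine 20 22 ∷ affine 20 23 ∷ affine 20 25 ∷ affine 20 27 ∷
    affine 20 28 ∷
    affine 21 0 ∷ affine 21 1 ∷ affine 21 3 ∷ affine 21 6 ∷ affine 21 7 ∷ affine 21 10 ∷
    affine 21 12 ∷ affine 21 14 ∷ affine 21 16 ∷ affine 21 17 ∷ affine 21 18 ∷ affine 21 19 ∷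
    affine 21 21 ∷ affine 21 23 ∷ affine 21 24 ∷ affine 21 25 ∷
    affine 22 0 ∷ affine 22 1 ∷ affine 22 2 ∷ affine 22 3 ∷ affine 22 5 ∷ affine 22 7 ∷
    affine 22 8 ∷ affine 22 9 ∷ affine 22 10 ∷ affine 22 12 ∷ affine 22 14 ∷ affine 22 16 ∷
    affine 22 17 ∷ affine 22 18 ∷ affine 22 19 ∷ affine 22 22 ∷ affine 22 24 ∷ affine 22 27 ∷
    affine 22 28 ∷
    affine 23 1 ∷ affine 23 2 ∷ affine 23 3 ∷ affine 23 5 ∷ affine 23 6 ∷ affine 23 7 ∷
    affine 23 9 ∷ affine 23 11 ∷ affine 23 15 ∷ affine 23 16 ∷ affine 23 17 ∷ affine 23 18 ∷
    affine 23 19 ∷ affine 23 20 ∷ affine 23 21 ∷ affine 23 23 ∷ affine 23 24 ∷ affine 23 25 ∷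
    affine 23 27 ∷
    affine 24 3 ∷ affine 24 5 ∷ affine 24 6 ∷ affine 24 7 ∷ affine 24 9 ∷ affine 24 10 ∷
    affine 24 13 ∷ affine 24 18 ∷ affine 24 20 ∷ affine 24 21 ∷ affine 24 25 ∷ affine 24 27 ∷
    affine 24 28 ∷
    affine 25 2 ∷ affine 25 4 ∷ affine 25 5 ∷ affine 25 6 ∷ affine 25 7 ∷ affine 25 8 ∷
    affine 25 10 ∷ affine 25 12 ∷ affine 25 13 ∷ affine 25 14 ∷ affine 25 15 ∷ affine 25 16 ∷
    affine 25 18 ∷ affine 25 20 ∷ affine 25 21 ∷ affine 25 22 ∷ affine 25 23 ∷ affine 25 27 ∷
    affine 25 28 ∷
    affine 26 0 ∷ affine 26 1 ∷ affine 26 2 ∷ affine 26 3 ∷ affine 26 7 ∷ affine 26 8 ∷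
    affine 26 10 ∷ affine 26 11 ∷ affine 26 13 ∷ affine 26 14 ∷ affine 26 15 ∷ affine 26 18 ∷
    affine 26 21 ∷ affine 26 22 ∷ affine 26 24 ∷ affine 26 25 ∷ affine 26 28 ∷
    affine 27 1 ∷ affine 27 2 ∷ affine 27 3 ∷ affine 27 4 ∷ affine 27 5 ∷ affine 27 7 ∷
    affine 27 10 ∷ affine 27 11 ∷ affine 27 12 ∷ affine 27 13 ∷ affine 27 16 ∷ affine 27 18 ∷
    affine 27 19 ∷ affine 27 20 ∷ affine 27 23 ∷ affine 27 24 ∷ affine 27 27 ∷ affine 27 28 ∷
    affine 28 2 ∷ affine 28 3 ∷ affine 28 4 ∷ affine 28 7 ∷ affine 28 8 ∷ affine 28 10 ∷
    affine 28 11 ∷ affine 28 13 ∷ affine 28 14 ∷ affine 28 15 ∷ affine 28 16 ∷ affine 28 17 ∷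
    affine 28 18 ∷ affine 28 19 ∷ affine 28 20 ∷ affine 28 21 ∷ affine 28 24 ∷ affine 28 27 ∷
    affine 28 28 ∷ []

  arc-507-19 : ArcExists 507 19
  arc-507-19 = checkedArc points-507-19 19 ⟦ affine 0 4 ⟧ refl

  points-534-20 : List Rep
  points-534-20 =
    ideal 0 ∷ ideal 1 ∷ ideal 5 ∷ ideal 6 ∷ ideal 8 ∷ ideal 9 ∷ ideal 11 ∷ ideal 13 ∷ ideal 14 ∷
    ideal 15 ∷ ideal 16 ∷ ideal 18 ∷ ideal 20 ∷ ideal 21 ∷ ideal 23 ∷ ideal 24 ∷ ideal 28 ∷
    affine 0 0 ∷ affine 0 1 ∷ affine 0 5 ∷ affine 0 6 ∷ affine 0 8 ∷ affine 0 9 ∷ affine 0 11 ∷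
    affine 0 13 ∷ affine 0 14 ∷ affine 0 15 ∷ affine 0 16 ∷ affine 0 18 ∷ affine 0 20 ∷
    affine 0 21 ∷ affine 0 23 ∷ affine 0 24 ∷ affine 0 28 ∷
    affine 1 0 ∷ affine 1 1 ∷ affine 1 5 ∷ affine 1 6 ∷ affine 1 8 ∷ affine 1 9 ∷ affine 1 11 ∷
    affine 1 13 ∷ affine 1 14 ∷ affine 1 15 ∷ affine 1 16 ∷ affine 1 18 ∷ affine 1 20 ∷
    affine 1 21 ∷ affine 1 23 ∷ affine 1 24 ∷ affine 1 28 ∷
    affine 2 0 ∷ affine 2 2 ∷ affine 2 3 ∷ affine 2 4 ∷ affine 2 5 ∷ affine 2 6 ∷ affine 2 9 ∷
    affine 2 12 ∷ affine 2 13 ∷ affine 2 16 ∷ affine 2 17 ∷ affine 2 20 ∷ affine 2 23 ∷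
    affine 2 24 ∷ affine 2 25 ∷ affine 2 26 ∷ affine 2 27 ∷
    affine 3 0 ∷ affine 3 1 ∷ affine 3 4 ∷ affine 3 6 ∷ affine 3 7 ∷ affine 3 8 ∷ affine 3 9 ∷
    affine 3 10 ∷ affine 3 19 ∷ affine 3 20 ∷ affine 3 21 ∷ affine 3 22 ∷ affine 3 23 ∷
    affine 3 25 ∷ affine 3 28 ∷
    affine 4 0 ∷ affine 4 2 ∷ affine 4 3 ∷ affine 4 4 ∷ affine 4 7 ∷ affine 4 8 ∷ affine 4 9 ∷
    affine 4 13 ∷ affine 4 14 ∷ affine 4 15 ∷ affine 4 16 ∷ affine 4 20 ∷ affine 4 21 ∷
    affine 4 22 ∷ affine 4 25 ∷ affine 4 26 ∷ affine 4 27 ∷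
    affine 5 1 ∷ affine 5 3 ∷ affine 5 4 ∷ affine 5 5 ∷ affine 5 7 ∷ affine 5 10 ∷ affine 5 11 ∷
    affine 5 12 ∷ affine 5 13 ∷ affine 5 14 ∷ affine 5 15 ∷ affine 5 16 ∷ affine 5 17 ∷
    affine 5 18 ∷ affine 5 19 ∷ affine 5 22 ∷ affine 5 24 ∷ affine 5 25 ∷ affine 5 26 ∷
    affine 5 28 ∷
    affine 6 1 ∷ affine 6 3 ∷ affine 6 4 ∷ affine 6 5 ∷ affine 6 6 ∷ affine 6 8 ∷ affine 6 13 ∷
    affine 6 14 ∷ affine 6 15 ∷ affine 6 16 ∷ affine 6 21 ∷ affine 6 23 ∷ affine 6 24 ∷
    affine 6 25 ∷ affine 6 26 ∷ affine 6 28 ∷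
    affine 7 1 ∷ affine 7 3 ∷ affine 7 4 ∷ affine 7 6 ∷ affine 7 7 ∷ affine 7 8 ∷ affine 7 9 ∷
    affine 7 10 ∷ affine 7 11 ∷ affine 7 12 ∷ affine 7 17 ∷ affine 7 18 ∷ affine 7 19 ∷
    affine 7 20 ∷ affine 7 21 ∷ affine 7 22 ∷ affine 7 23 ∷ affine 7 25 ∷ affine 7 26 ∷
    affine 7 28 ∷
    affine 8 0 ∷ affine 8 1 ∷ affine 8 2 ∷ affine 8 4 ∷ affine 8 5 ∷ affine 8 8 ∷ affine 8 9 ∷
    affine 8 11 ∷ affine 8 14 ∷ affine 8 15 ∷ affine 8 18 ∷ affine 8 20 ∷ affine 8 21 ∷
    affine 8 24 ∷ affine 8 25 ∷ affine 8 27 ∷ affine 8 28 ∷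
    affine 9 2 ∷ affine 9 3 ∷ affine 9 4 ∷ affine 9 5 ∷ affine 9 6 ∷ affine 9 7 ∷ affine 9 8 ∷
    affine 9 11 ∷ affine 9 12 ∷ affine 9 14 ∷ affine 9 15 ∷ affine 9 17 ∷ affine 9 18 ∷
    affine 9 21 ∷ affine 9 22 ∷ affine 9 23 ∷ affine 9 24 ∷ affine 9 25 ∷ affine 9 26 ∷
    affine 9 27 ∷
    affine 10 0 ∷ affine 10 3 ∷ affine 10 4 ∷ affine 10 5 ∷ affine 10 7 ∷ affine 10 9 ∷
    affine 10 10 ∷ affine 10 12 ∷ affine 10 13 ∷ affine 10 16 ∷ affine 10 17 ∷ affine 10 19 ∷
    affine 10 20 ∷ affine 10 22 ∷ affine 10 24 ∷ affine 10 25 ∷ affine 10 26 ∷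
    affine 11 0 ∷ affine 11 2 ∷ affine 11 4 ∷ affine 11 5 ∷ affine 11 6 ∷ affine 11 7 ∷
    affine 11 8 ∷ affine 11 10 ∷ affine 11 12 ∷ affine 11 13 ∷ affine 11 16 ∷ affine 11 17 ∷
    affine 11 19 ∷ affine 11 21 ∷ affine 11 22 ∷ affine 11 23 ∷ affine 11 24 ∷ affine 11 25 ∷
    affine 11 27 ∷
    affine 12 1 ∷ affine 12 2 ∷ affine 12 4 ∷ affine 12 6 ∷ affine 12 9 ∷ affine 12 10 ∷
    affine 12 11 ∷ affine 12 12 ∷ affine 12 13 ∷ affine 12 14 ∷ affine 12 15 ∷ affine 12 16 ∷
    affine 12 17 ∷ affine 12 18 ∷ affine 12 19 ∷ affine 12 20 ∷ affine 12 23 ∷ affine 12 25 ∷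
    affine 12 27 ∷ affine 12 28 ∷
    affine 13 1 ∷ affine 13 4 ∷ affine 13 5 ∷ affine 13 6 ∷ affine 13 8 ∷ affine 13 10 ∷
    affine 13 11 ∷ affine 13 12 ∷ affine 13 13 ∷ affine 13 14 ∷ affine 13 15 ∷ affine 13 16 ∷
    affine 13 17 ∷ affine 13 18 ∷ affine 13 19 ∷ affine 13 21 ∷ affine 13 23 ∷ affine 13 24 ∷
    affine 13 25 ∷ affine 13 28 ∷
    affine 14 0 ∷ affine 14 2 ∷ affine 14 3 ∷ affine 14 4 ∷ affine 14 5 ∷ affine 14 10 ∷
    affine 14 11 ∷ affine 14 14 ∷ affine 14 15 ∷ affine 14 18 ∷ affine 14 19 ∷ affine 14 24 ∷
    affine 14 25 ∷ affine 14 26 ∷ affine 14 27 ∷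
    affine 15 0 ∷ affine 15 1 ∷ affine 15 2 ∷ affine 15 3 ∷ affine 15 6 ∷ affine 15 8 ∷
    affine 15 10 ∷ affine 15 12 ∷ affine 15 13 ∷ affine 15 16 ∷ affine 15 17 ∷ affine 15 19 ∷
    affine 15 21 ∷ affine 15 23 ∷ affine 15 26 ∷ affine 15 27 ∷ affine 15 28 ∷
    affine 16 0 ∷ affine 16 1 ∷ affine 16 4 ∷ affine 16 5 ∷ affine 16 6 ∷ affine 16 7 ∷
    affine 16 10 ∷ affine 16 11 ∷ affine 16 14 ∷ affine 16 15 ∷ affine 16 18 ∷ affine 16 19 ∷
    affine 16 22 ∷ affine 16 23 ∷ affine 16 24 ∷ affine 16 25 ∷ affine 16 28 ∷
    affine 17 2 ∷ affine 17 3 ∷ affine 17 4 ∷ affine 17 6 ∷ affine 17 7 ∷ affine 17 8 ∷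
    affine 17 9 ∷ affine 17 10 ∷ affine 17 11 ∷ affine 17 12 ∷ affine 17 17 ∷ affine 17 18 ∷
    affine 17 19 ∷ affine 17 20 ∷ affine 17 21 ∷ affine 17 22 ∷ affine 17 23 ∷ affine 17 25 ∷
    affine 17 26 ∷ affine 17 27 ∷
    affine 18 1 ∷ affine 18 3 ∷ affine 18 4 ∷ affine 18 5 ∷ affine 18 7 ∷ affine 18 8 ∷
    affine 18 9 ∷ affine 18 10 ∷ affine 18 13 ∷ affine 18 14 ∷ affine 18 15 ∷ affine 18 16 ∷
    affine 18 19 ∷ affine 18 20 ∷ affine 18 21 ∷ affine 18 22 ∷ affine 18 24 ∷ affine 18 25 ∷
    affine 18 26 ∷ affine 18 28 ∷
    affine 19 0 ∷ affine 19 1 ∷ affine 19 3 ∷ affine 19 5 ∷ affine 19 7 ∷ affine 19 9 ∷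
    affine 19 11 ∷ affine 19 12 ∷ affine 19 14 ∷ affine 19 15 ∷ affine 19 17 ∷ affine 19 18 ∷
    affine 19 20 ∷ affine 19 22 ∷ affine 19 24 ∷ affine 19 26 ∷ affine 19 28 ∷
    affine 20 0 ∷ affine 20 2 ∷ affine 20 3 ∷ affine 20 7 ∷ affine 20 10 ∷ affine 20 11 ∷
    affine 20 12 ∷ affine 20 13 ∷ affine 20 16 ∷ affine 20 17 ∷ affine 20 18 ∷ affine 20 19 ∷
    affine 20 22 ∷ affine 20 26 ∷ affine 20 27 ∷
    affine 21 1 ∷ affine 21 3 ∷ affine 21 4 ∷ affine 21 7 ∷ affine 21 8 ∷ affine 21 9 ∷
    affine 21 10 ∷ affine 21 12 ∷ affine 21 13 ∷ affine 21 14 ∷ affine 21 15 ∷ affine 21 16 ∷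
    affine 21 17 ∷ affine 21 19 ∷ affine 21 20 ∷ affine 21 21 ∷ affine 21 22 ∷ affine 21 25 ∷
    affine 21 26 ∷ affine 21 28 ∷
    affine 22 0 ∷ affine 22 2 ∷ affine 22 3 ∷ affine 22 6 ∷ affine 22 7 ∷ affine 22 9 ∷
    affine 22 10 ∷ affine 22 11 ∷ affine 22 12 ∷ affine 22 13 ∷ affine 22 16 ∷ affine 22 17 ∷
    affine 22 18 ∷ affine 22 19 ∷ affine 22 20 ∷ affine 22 22 ∷ affine 22 23 ∷ affine 22 26 ∷
    affine 22 27 ∷
    affine 23 1 ∷ affine 23 3 ∷ affine 23 5 ∷ affine 23 6 ∷ affine 23 7 ∷ affine 23 9 ∷
    affine 23 10 ∷ affine 23 11 ∷ affine 23 18 ∷ affine 23 19 ∷ affine 23 20 ∷ affine 23 22 ∷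
    affine 23 23 ∷ affine 23 24 ∷ affine 23 26 ∷ affine 23 28 ∷
    affine 24 1 ∷ affine 24 2 ∷ affine 24 3 ∷ affine 24 5 ∷ affine 24 6 ∷ affine 24 8 ∷
    affine 24 9 ∷ affine 24 11 ∷ affine 24 13 ∷ affine 24 14 ∷ affine 24 15 ∷ affine 24 16 ∷
    affine 24 18 ∷ affine 24 20 ∷ affine 24 21 ∷ affine 24 23 ∷ affine 24 24 ∷ affine 24 26 ∷
    affine 24 27 ∷ affine 24 28 ∷
    affine 25 1 ∷ affine 25 4 ∷ affine 25 5 ∷ affine 25 7 ∷ affine 25 9 ∷ affine 25 11 ∷
    affine 25 12 ∷ affine 25 14 ∷ affine 25 15 ∷ affine 25 17 ∷ affine 25 18 ∷ affine 25 20 ∷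
    affine 25 22 ∷ affine 25 24 ∷ affine 25 25 ∷ affine 25 28 ∷
    affine 26 0 ∷ affine 26 1 ∷ affine 26 5 ∷ affine 26 6 ∷ affine 26 7 ∷ affine 26 8 ∷
    affine 26 10 ∷ affine 26 11 ∷ affine 26 12 ∷ affine 26 14 ∷ affine 26 15 ∷ affine 26 17 ∷
    affine 26 18 ∷ affine 26 19 ∷ affine 26 21 ∷ affine 26 22 ∷ affine 26 23 ∷ affine 26 24 ∷
    affine 26 28 ∷
    affine 27 0 ∷ affine 27 1 ∷ affine 27 2 ∷ affine 27 7 ∷ affine 27 8 ∷ affine 27 9 ∷
    affine 27 10 ∷ affine 27 12 ∷ affine 27 14 ∷ affine 27 15 ∷ affine 27 17 ∷ affine 27 19 ∷
    affine 27 20 ∷ affine 27 21 ∷ affine 27 22 ∷ affine 27 27 ∷ affine 27 28 ∷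
    affine 28 0 ∷ affine 28 2 ∷ affine 28 3 ∷ affine 28 4 ∷ affine 28 5 ∷ affine 28 6 ∷
    affine 28 9 ∷ affine 28 12 ∷ affine 28 13 ∷ affine 28 16 ∷ affine 28 17 ∷ affine 28 20 ∷
    affine 28 23 ∷ affine 28 24 ∷ affine 28 25 ∷ affine 28 26 ∷ affine 28 27 ∷ []

  arc-534-20 : ArcExists 534 20
  arc-534-20 = checkedArc points-534-20 20 ⟦ affine 0 1 ⟧ refl

  points-565-21 : List Rep
  points-565-21 =
    ideal 0 ∷ ideal 1 ∷ ideal 2 ∷ ideal 3 ∷ ideal 5 ∷ ideal 6 ∷ ideal 8 ∷ ideal 9 ∷ ideal 11 ∷
    ideal 12 ∷ ideal 13 ∷ ideal 14 ∷ ideal 15 ∷ ideal 16 ∷ ideal 18 ∷ ideal 19 ∷ ideal 20 ∷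
    ideal 21 ∷ ideal 22 ∷ ideal 25 ∷ ideal 27 ∷
    affine 0 0 ∷ affine 0 2 ∷ affine 0 4 ∷ affine 0 7 ∷ affine 0 8 ∷ affine 0 9 ∷ affine 0 10 ∷
    affine 0 11 ∷ affine 0 13 ∷ affine 0 14 ∷ affine 0 15 ∷ affine 0 16 ∷ affine 0 17 ∷
    affine 0 18 ∷ affine 0 20 ∷ affine 0 21 ∷ affine 0 23 ∷ affine 0 24 ∷ affine 0 26 ∷
    affine 0 27 ∷ affine 0 28 ∷
    affine 1 2 ∷ affine 1 3 ∷ affine 1 4 ∷ affine 1 5 ∷ affine 1 6 ∷ affine 1 7 ∷ affine 1 9 ∷
    affine 1 12 ∷ affine 1 15 ∷ affine 1 16 ∷ affine 1 17 ∷ affine 1 19 ∷ affine 1 20 ∷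
    affine 1 23 ∷ affine 1 24 ∷ affine 1 25 ∷ affine 1 26 ∷ affine 1 27 ∷
    affine 2 1 ∷ affine 2 2 ∷ affine 2 3 ∷ affine 2 4 ∷ affine 2 5 ∷ affine 2 8 ∷ affine 2 11 ∷
    affine 2 12 ∷ affine 2 17 ∷ affine 2 18 ∷ affine 2 21 ∷ affine 2 24 ∷ affine 2 25 ∷
    affine 2 26 ∷ affine 2 27 ∷ affine 2 28 ∷
    affine 3 0 ∷ affine 3 1 ∷ affine 3 2 ∷ affine 3 3 ∷ affine 3 5 ∷ affine 3 6 ∷ affine 3 7 ∷
    affine 3 8 ∷ affine 3 10 ∷ affine 3 11 ∷ affine 3 12 ∷ affine 3 13 ∷ affine 3 15 ∷ affine 3 17 ∷
    affine 3 20 ∷ affine 3 21 ∷ affine 3 24 ∷ affine 3 25 ∷ affine 3 26 ∷ affine 3 27 ∷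
    affine 3 28 ∷
    affine 4 2 ∷ affine 4 3 ∷ affine 4 4 ∷ affine 4 5 ∷ affine 4 6 ∷ affine 4 7 ∷ affine 4 9 ∷
    affine 4 12 ∷ affine 4 15 ∷ affine 4 16 ∷ affine 4 17 ∷ affine 4 19 ∷ affine 4 20 ∷
    affine 4 23 ∷ affine 4 24 ∷ affine 4 25 ∷ affine 4 26 ∷ affine 4 27 ∷
    affine 5 0 ∷ affine 5 1 ∷ affine 5 2 ∷ affine 5 3 ∷ affine 5 5 ∷ affine 5 6 ∷ affine 5 8 ∷
    affine 5 9 ∷ affine 5 11 ∷ affine 5 12 ∷ affine 5 13 ∷ affine 5 14 ∷ affine 5 15 ∷ affine 5 16 ∷
    affine 5 18 ∷ affine 5 19 ∷ affine 5 20 ∷ affine 5 21 ∷ affine 5 22 ∷ affine 5 25 ∷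
    affine 5 27 ∷
    affine 6 0 ∷ affine 6 2 ∷ affine 6 3 ∷ affine 6 4 ∷ affine 6 8 ∷ affine 6 9 ∷ affine 6 10 ∷
    affine 6 11 ∷ affine 6 12 ∷ affine 6 13 ∷ affine 6 15 ∷ affine 6 17 ∷ affine 6 19 ∷
    affine 6 20 ∷ affine 6 21 ∷ affine 6 22 ∷ affine 6 23 ∷ affine 6 24 ∷ affine 6 25 ∷
    affine 6 26 ∷ affine 6 28 ∷
    affine 7 0 ∷ affine 7 1 ∷ affine 7 2 ∷ affine 7 3 ∷ affine 7 6 ∷ affine 7 7 ∷ affine 7 8 ∷
    affine 7 9 ∷ affine 7 10 ∷ affine 7 11 ∷ affine 7 12 ∷ affine 7 16 ∷ affine 7 18 ∷ affine 7 19 ∷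
    affine 7 22 ∷ affine 7 24 ∷ affine 7 25 ∷ affine 7 26 ∷ affine 7 28 ∷
    affine 8 2 ∷ affine 8 3 ∷ affine 8 6 ∷ affine 8 7 ∷ affine 8 10 ∷ affine 8 11 ∷ affine 8 12 ∷
    affine 8 13 ∷ affine 8 16 ∷ affine 8 17 ∷ affine 8 18 ∷ affine 8 19 ∷ affine 8 22 ∷
    affine 8 23 ∷ affine 8 26 ∷ affine 8 27 ∷
    affine 9 0 ∷ affine 9 1 ∷ affine 9 4 ∷ affine 9 5 ∷ affine 9 10 ∷ affine 9 11 ∷ affine 9 12 ∷
    affine 9 14 ∷ affine 9 15 ∷ affine 9 16 ∷ affine 9 17 ∷ affine 9 18 ∷ affine 9 20 ∷
    affine 9 21 ∷ affine 9 22 ∷ affine 9 23 ∷ affine 9 25 ∷ affine 9 26 ∷ affine 9 28 ∷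
    affine 10 1 ∷ affine 10 4 ∷ affine 10 6 ∷ affine 10 7 ∷ affine 10 8 ∷ affine 10 9 ∷
    affine 10 10 ∷ affine 10 11 ∷ affine 10 18 ∷ affine 10 19 ∷ affine 10 20 ∷ affine 10 21 ∷
    affine 10 22 ∷ affine 10 23 ∷ affine 10 25 ∷ affine 10 28 ∷
    affine 11 0 ∷ affine 11 2 ∷ affine 11 3 ∷ affine 11 4 ∷ affine 11 5 ∷ affine 11 6 ∷
    affine 11 7 ∷ affine 11 8 ∷ affine 11 9 ∷ affine 11 10 ∷ affine 11 13 ∷ affine 11 15 ∷
    affine 11 16 ∷ affine 11 17 ∷ affine 11 18 ∷ affine 11 19 ∷ affine 11 23 ∷ affine 11 24 ∷
    affine 11 25 ∷ affine 11 27 ∷ affine 11 28 ∷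
    affine 12 1 ∷ affine 12 3 ∷ affine 12 4 ∷ affine 12 5 ∷ affine 12 6 ∷ affine 12 8 ∷
    affine 12 9 ∷ affine 12 11 ∷ affine 12 12 ∷ affine 12 13 ∷ affine 12 14 ∷ affine 12 15 ∷
    affine 12 16 ∷ affine 12 21 ∷ affine 12 23 ∷ affine 12 24 ∷ affine 12 26 ∷ affine 12 28 ∷
    affine 13 1 ∷ affine 13 2 ∷ affine 13 3 ∷ affine 13 4 ∷ affine 13 6 ∷ affine 13 7 ∷
    affine 13 8 ∷ affine 13 10 ∷ affine 13 11 ∷ affine 13 13 ∷ affine 13 16 ∷ affine 13 18 ∷
    affine 13 21 ∷ affine 13 22 ∷ affine 13 23 ∷ affine 13 24 ∷ affine 13 25 ∷ affine 13 27 ∷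
    affine 14 0 ∷ affine 14 2 ∷ affine 14 5 ∷ affine 14 9 ∷ affine 14 10 ∷ affine 14 11 ∷
    affine 14 13 ∷ affine 14 14 ∷ affine 14 15 ∷ affine 14 16 ∷ affine 14 17 ∷ affine 14 18 ∷
    affine 14 20 ∷ affine 14 21 ∷ affine 14 23 ∷ affine 14 24 ∷ affine 14 25 ∷ affine 14 26 ∷
    affine 14 28 ∷
    affine 15 0 ∷ affine 15 1 ∷ affine 15 3 ∷ affine 15 4 ∷ affine 15 5 ∷ affine 15 6 ∷
    affine 15 10 ∷ affine 15 12 ∷ affine 15 13 ∷ affine 15 14 ∷ affine 15 15 ∷ affine 15 16 ∷
    affine 15 17 ∷ affine 15 18 ∷ affine 15 20 ∷ affine 15 21 ∷ affine 15 22 ∷ affine 15 23 ∷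
    affine 15 25 ∷ affine 15 27 ∷ affine 15 28 ∷
    affine 16 0 ∷ affine 16 1 ∷ affine 16 2 ∷ affine 16 3 ∷ affine 16 5 ∷ affine 16 7 ∷
    affine 16 8 ∷ affine 16 10 ∷ affine 16 11 ∷ affine 16 13 ∷ affine 16 15 ∷ affine 16 17 ∷
    affine 16 20 ∷ affine 16 21 ∷ affine 16 22 ∷ affine 16 23 ∷ affine 16 24 ∷ affine 16 27 ∷
    affine 16 28 ∷
    affine 17 1 ∷ affine 17 2 ∷ affine 17 6 ∷ affine 17 7 ∷ affine 17 8 ∷ affine 17 9 ∷
    affine 17 10 ∷ affine 17 11 ∷ affine 17 12 ∷ affine 17 13 ∷ affine 17 14 ∷ affine 17 15 ∷
    affine 17 17 ∷ affine 17 18 ∷ affine 17 20 ∷ affine 17 22 ∷ affine 17 23 ∷ affine 17 27 ∷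
    affine 18 1 ∷ affine 18 2 ∷ affine 18 5 ∷ affine 18 6 ∷ affine 18 7 ∷ affine 18 8 ∷
    affine 18 10 ∷ affine 18 14 ∷ affine 18 15 ∷ affine 18 18 ∷ affine 18 19 ∷ affine 18 21 ∷
    affine 18 22 ∷ affine 18 24 ∷ affine 18 25 ∷ affine 18 26 ∷ affine 18 27 ∷ affine 18 28 ∷
    affine 19 1 ∷ affine 19 2 ∷ affine 19 4 ∷ affine 19 6 ∷ affine 19 9 ∷ affine 19 12 ∷
    affine 19 13 ∷ affine 19 14 ∷ affine 19 15 ∷ affine 19 16 ∷ affine 19 17 ∷ affine 19 20 ∷
    affine 19 23 ∷ affine 19 25 ∷ affine 19 27 ∷ affine 19 28 ∷
    affine 20 3 ∷ affine 20 4 ∷ affine 20 5 ∷ affine 20 7 ∷ affine 20 9 ∷ affine 20 10 ∷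
    affine 20 11 ∷ affine 20 12 ∷ affine 20 13 ∷ affine 20 14 ∷ affine 20 15 ∷ affine 20 16 ∷
    affine 20 18 ∷ affine 20 19 ∷ affine 20 20 ∷ affine 20 24 ∷ affine 20 26 ∷ affine 20 27 ∷
    affine 21 0 ∷ affine 21 2 ∷ affine 21 5 ∷ affine 21 6 ∷ affine 21 7 ∷ affine 21 8 ∷
    affine 21 9 ∷ affine 21 11 ∷ affine 21 12 ∷ affine 21 13 ∷ affine 21 14 ∷ affine 21 16 ∷
    affine 21 18 ∷ affine 21 19 ∷ affine 21 21 ∷ affine 21 23 ∷ affine 21 25 ∷ affine 21 27 ∷
    affine 21 28 ∷
    affine 22 1 ∷ affine 22 3 ∷ affine 22 4 ∷ affine 22 5 ∷ affine 22 6 ∷ affine 22 8 ∷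
    affine 22 9 ∷ affine 22 11 ∷ affine 22 12 ∷ affine 22 13 ∷ affine 22 14 ∷ affine 22 15 ∷
    affine 22 16 ∷ affine 22 21 ∷ affine 22 23 ∷ affine 22 24 ∷ affine 22 26 ∷ affine 22 28 ∷
    affine 23 2 ∷ affine 23 4 ∷ affine 23 5 ∷ affine 23 6 ∷ affine 23 7 ∷ affine 23 8 ∷
    affine 23 10 ∷ affine 23 13 ∷ affine 23 16 ∷ affine 23 19 ∷ affine 23 21 ∷ affine 23 22 ∷
    affine 23 23 ∷ affine 23 24 ∷ affine 23 25 ∷ affine 23 27 ∷
    affine 24 0 ∷ affine 24 1 ∷ affine 24 2 ∷ affine 24 4 ∷ affine 24 5 ∷ affine 24 7 ∷
    affine 24 8 ∷ affine 24 9 ∷ affine 24 10 ∷ affine 24 12 ∷ affine 24 13 ∷ affine 24 14 ∷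
    affine 24 18 ∷ affine 24 19 ∷ affine 24 20 ∷ affine 24 21 ∷ affine 24 22 ∷ affine 24 23 ∷
    affine 24 25 ∷ affine 24 26 ∷ affine 24 28 ∷
    affine 25 1 ∷ affine 25 3 ∷ affine 25 4 ∷ affine 25 5 ∷ affine 25 7 ∷ affine 25 9 ∷
    affine 25 11 ∷ affine 25 12 ∷ affine 25 13 ∷ affine 25 14 ∷ affine 25 15 ∷ affine 25 17 ∷
    affine 25 18 ∷ affine 25 22 ∷ affine 25 24 ∷ affine 25 25 ∷ affine 25 27 ∷ affine 25 28 ∷
    affine 26 0 ∷ affine 26 3 ∷ affine 26 4 ∷ affine 26 6 ∷ affine 26 7 ∷ affine 26 10 ∷
    affine 26 11 ∷ affine 26 12 ∷ affine 26 13 ∷ affine 26 14 ∷ affine 26 16 ∷ affine 26 17 ∷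
    affine 26 18 ∷ affine 26 19 ∷ affine 26 20 ∷ affine 26 21 ∷ affine 26 22 ∷ affine 26 24 ∷
    affine 26 26 ∷ affine 26 27 ∷ affine 26 28 ∷
    affine 27 1 ∷ affine 27 3 ∷ affine 27 4 ∷ affine 27 5 ∷ affine 27 6 ∷ affine 27 7 ∷
    affine 27 9 ∷ affine 27 10 ∷ affine 27 11 ∷ affine 27 15 ∷ affine 27 18 ∷ affine 27 19 ∷
    affine 27 20 ∷ affine 27 21 ∷ affine 27 22 ∷ affine 27 23 ∷ affine 27 26 ∷ affine 27 28 ∷
    affine 28 0 ∷ affine 28 1 ∷ affine 28 3 ∷ affine 28 4 ∷ affine 28 5 ∷ affine 28 6 ∷
    affine 28 7 ∷ affine 28 8 ∷ affine 28 9 ∷ affine 28 10 ∷ affine 28 12 ∷ affine 28 14 ∷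
    affine 28 16 ∷ affine 28 17 ∷ affine 28 18 ∷ affine 28 19 ∷ affine 28 20 ∷ affine 28 21 ∷
    affine 28 25 ∷ affine 28 26 ∷ affine 28 27 ∷ []

  arc-565-21 : ArcExists 565 21
  arc-565-21 = checkedArc points-565-21 21 ⟦ affine 0 0 ⟧ refl

  points-595-22 : List Rep
  points-595-22 =
    ideal 0 ∷ ideal 1 ∷ ideal 2 ∷ ideal 3 ∷ ideal 6 ∷ ideal 7 ∷ ideal 8 ∷ ideal 9 ∷ ideal 10 ∷
    ideal 12 ∷ ideal 13 ∷ ideal 14 ∷ ideal 16 ∷ ideal 19 ∷ ideal 21 ∷ ideal 23 ∷ ideal 24 ∷
    ideal 27 ∷ ideal 28 ∷
    affine 0 0 ∷ affine 0 1 ∷ affine 0 2 ∷ affine 0 3 ∷ affine 0 4 ∷ affine 0 6 ∷ affine 0 8 ∷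
    affine 0 9 ∷ affine 0 10 ∷ affine 0 11 ∷ affine 0 12 ∷ affine 0 13 ∷ affine 0 15 ∷ affine 0 16 ∷
    affine 0 17 ∷ affine 0 19 ∷ affine 0 20 ∷ affine 0 21 ∷ affine 0 23 ∷ affine 0 24 ∷
    affine 0 27 ∷ affine 0 28 ∷
    affine 1 0 ∷ affine 1 1 ∷ affine 1 2 ∷ affine 1 3 ∷ affine 1 7 ∷ affine 1 8 ∷ affine 1 10 ∷
    affine 1 12 ∷ affine 1 14 ∷ affine 1 16 ∷ affine 1 18 ∷ affine 1 20 ∷ affine 1 21 ∷
    affine 1 23 ∷ affine 1 26 ∷ affine 1 27 ∷ affine 1 28 ∷
    affine 2 0 ∷ affine 2 1 ∷ affine 2 2 ∷ affine 2 3 ∷ affine 2 5 ∷ affine 2 6 ∷ affine 2 7 ∷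
    affine 2 9 ∷ affine 2 10 ∷ affine 2 11 ∷ affine 2 14 ∷ affine 2 16 ∷ affine 2 17 ∷ affine 2 18 ∷
    affine 2 19 ∷ affine 2 20 ∷ affine 2 21 ∷ affine 2 22 ∷ affine 2 23 ∷ affine 2 25 ∷
    affine 2 27 ∷ affine 2 28 ∷
    affine 3 1 ∷ affine 3 2 ∷ affine 3 3 ∷ affine 3 4 ∷ affine 3 5 ∷ affine 3 6 ∷ affine 3 7 ∷
    affine 3 8 ∷ affine 3 10 ∷ affine 3 11 ∷ affine 3 13 ∷ affine 3 14 ∷ affine 3 15 ∷ affine 3 16 ∷
    affine 3 18 ∷ affine 3 19 ∷ affine 3 20 ∷ affine 3 21 ∷ affine 3 22 ∷ affine 3 23 ∷
    affine 3 25 ∷ affine 3 27 ∷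
    affine 4 0 ∷ affine 4 1 ∷ affine 4 2 ∷ affine 4 3 ∷ affine 4 4 ∷ affine 4 7 ∷ affine 4 9 ∷
    affine 4 10 ∷ affine 4 11 ∷ affine 4 13 ∷ affine 4 14 ∷ affine 4 16 ∷ affine 4 18 ∷
    affine 4 22 ∷ affine 4 23 ∷ affine 4 24 ∷ affine 4 25 ∷ affine 4 26 ∷ affine 4 28 ∷
    affine 5 0 ∷ affine 5 2 ∷ affine 5 4 ∷ affine 5 7 ∷ affine 5 8 ∷ affine 5 9 ∷ affine 5 11 ∷
    affine 5 12 ∷ affine 5 14 ∷ affine 5 15 ∷ affine 5 16 ∷ affine 5 17 ∷ affine 5 18 ∷
    affine 5 20 ∷ affine 5 21 ∷ affine 5 22 ∷ affine 5 24 ∷ affine 5 26 ∷ affine 5 27 ∷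
    affine 5 28 ∷
    affine 6 2 ∷ affine 6 3 ∷ affine 6 4 ∷ affine 6 5 ∷ affine 6 6 ∷ affine 6 7 ∷ affine 6 8 ∷
    affine 6 9 ∷ affine 6 10 ∷ affine 6 11 ∷ affine 6 12 ∷ affine 6 14 ∷ affine 6 16 ∷ affine 6 17 ∷
    affine 6 18 ∷ affine 6 19 ∷ affine 6 20 ∷ affine 6 21 ∷ affine 6 23 ∷ affine 6 24 ∷
    affine 6 27 ∷
    affine 7 1 ∷ affine 7 2 ∷ affine 7 3 ∷ affine 7 5 ∷ affine 7 7 ∷ affine 7 8 ∷ affine 7 9 ∷
    affine 7 11 ∷ affine 7 13 ∷ affine 7 15 ∷ affine 7 16 ∷ affine 7 18 ∷ affine 7 19 ∷
    affine 7 22 ∷ affine 7 23 ∷ affine 7 24 ∷ affine 7 25 ∷ affine 7 27 ∷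
    affine 8 1 ∷ affine 8 2 ∷ affine 8 3 ∷ affine 8 4 ∷ affine 8 5 ∷ affine 8 6 ∷ affine 8 7 ∷
    affine 8 10 ∷ affine 8 11 ∷ affine 8 13 ∷ affine 8 15 ∷ affine 8 16 ∷ affine 8 17 ∷
    affine 8 18 ∷ affine 8 19 ∷ affine 8 20 ∷ affine 8 21 ∷ affine 8 22 ∷ affine 8 24 ∷
    affine 8 26 ∷ affine 8 28 ∷
    affine 9 0 ∷ affine 9 2 ∷ affine 9 6 ∷ affine 9 7 ∷ affine 9 8 ∷ affine 9 9 ∷ affine 9 10 ∷
    affine 9 11 ∷ affine 9 13 ∷ affine 9 16 ∷ affine 9 17 ∷ affine 9 18 ∷ affine 9 19 ∷
    affine 9 21 ∷ affine 9 22 ∷ affine 9 23 ∷ affine 9 24 ∷ affine 9 26 ∷ affine 9 27 ∷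
    affine 10 0 ∷ affine 10 2 ∷ affine 10 4 ∷ affine 10 5 ∷ affine 10 7 ∷ affine 10 8 ∷
    affine 10 9 ∷ affine 10 10 ∷ affine 10 11 ∷ affine 10 13 ∷ affine 10 14 ∷ affine 10 15 ∷
    affine 10 18 ∷ affine 10 20 ∷ affine 10 21 ∷ affine 10 22 ∷ affine 10 24 ∷ affine 10 25 ∷
    affine 10 26 ∷ affine 10 27 ∷ affine 10 28 ∷
    affine 11 0 ∷ affine 11 2 ∷ affine 11 3 ∷ affine 11 4 ∷ affine 11 5 ∷ affine 11 6 ∷
    affine 11 7 ∷ affine 11 8 ∷ affine 11 9 ∷ affine 11 12 ∷ affine 11 13 ∷ affine 11 15 ∷
    affine 11 17 ∷ affine 11 18 ∷ affine 11 19 ∷ affine 11 21 ∷ affine 11 22 ∷ affine 11 23 ∷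
    affine 11 24 ∷ affine 11 25 ∷ affine 11 26 ∷ affine 11 28 ∷
    affine 12 0 ∷ affine 12 3 ∷ affine 12 4 ∷ affine 12 6 ∷ affine 12 7 ∷ affine 12 10 ∷
    affine 12 12 ∷ affine 12 13 ∷ affine 12 14 ∷ affine 12 15 ∷ affine 12 17 ∷ affine 12 18 ∷
    affine 12 19 ∷ affine 12 20 ∷ affine 12 21 ∷ affine 12 22 ∷ affine 12 23 ∷ affine 12 25 ∷
    affine 12 26 ∷ affine 12 27 ∷ affine 12 28 ∷
    affine 13 0 ∷ affine 13 1 ∷ affine 13 3 ∷ affine 13 4 ∷ affine 13 6 ∷ affine 13 7 ∷
    affine 13 9 ∷ affine 13 10 ∷ affine 13 11 ∷ affine 13 12 ∷ affine 13 13 ∷ affine 13 14 ∷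
    affine 13 15 ∷ affine 13 16 ∷ affine 13 18 ∷ affine 13 19 ∷ affine 13 22 ∷ affine 13 23 ∷
    affine 13 24 ∷ affine 13 26 ∷ affine 13 27 ∷
    affine 14 0 ∷ affine 14 1 ∷ affine 14 4 ∷ affine 14 6 ∷ affine 14 7 ∷ affine 14 8 ∷
    affine 14 9 ∷ affine 14 10 ∷ affine 14 11 ∷ affine 14 14 ∷ affine 14 15 ∷ affine 14 17 ∷
    affine 14 18 ∷ affine 14 19 ∷ affine 14 20 ∷ affine 14 21 ∷ affine 14 22 ∷ affine 14 23 ∷
    affine 14 24 ∷ affine 14 25 ∷ affine 14 27 ∷ affine 14 28 ∷
    affine 15 0 ∷ affine 15 4 ∷ affine 15 5 ∷ affine 15 6 ∷ affine 15 8 ∷ affine 15 9 ∷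
    affine 15 10 ∷ affine 15 11 ∷ affine 15 12 ∷ affine 15 14 ∷ affine 15 15 ∷ affine 15 16 ∷
    affine 15 17 ∷ affine 15 20 ∷ affine 15 22 ∷ affine 15 23 ∷ affine 15 24 ∷ affine 15 26 ∷
    affine 15 27 ∷ affine 15 28 ∷
    affine 16 0 ∷ affine 16 1 ∷ affine 16 2 ∷ affine 16 3 ∷ affine 16 5 ∷ affine 16 6 ∷
    affine 16 8 ∷ affine 16 9 ∷ affine 16 10 ∷ affine 16 12 ∷ affine 16 13 ∷ affine 16 14 ∷
    affine 16 15 ∷ affine 16 16 ∷ affine 16 17 ∷ affine 16 19 ∷ affine 16 20 ∷ affine 16 21 ∷
    affine 16 25 ∷ affine 16 26 ∷
    affine 17 0 ∷ affine 17 1 ∷ affine 17 2 ∷ affine 17 3 ∷ affine 17 5 ∷ affine 17 7 ∷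
    affine 17 8 ∷ affine 17 9 ∷ affine 17 10 ∷ affine 17 11 ∷ affine 17 12 ∷ affine 17 13 ∷
    affine 17 16 ∷ affine 17 17 ∷ affine 17 20 ∷ affine 17 21 ∷ affine 17 22 ∷ affine 17 23 ∷
    affine 17 24 ∷ affine 17 26 ∷ affine 17 27 ∷ affine 17 28 ∷
    affine 18 0 ∷ affine 18 1 ∷ affine 18 2 ∷ affine 18 3 ∷ affine 18 4 ∷ affine 18 6 ∷
    affine 18 7 ∷ affine 18 8 ∷ affine 18 10 ∷ affine 18 11 ∷ affine 18 12 ∷ affine 18 13 ∷
    affine 18 15 ∷ affine 18 16 ∷ affine 18 18 ∷ affine 18 20 ∷ affine 18 21 ∷ affine 18 24 ∷
    affine 18 25 ∷ affine 18 26 ∷ affine 18 27 ∷ affine 18 28 ∷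
    affine 19 1 ∷ affine 19 2 ∷ affine 19 3 ∷ affine 19 4 ∷ affine 19 6 ∷ affine 19 7 ∷
    affine 19 8 ∷ affine 19 9 ∷ affine 19 12 ∷ affine 19 13 ∷ affine 19 14 ∷ affine 19 15 ∷
    affine 19 16 ∷ affine 19 17 ∷ affine 19 18 ∷ affine 19 21 ∷ affine 19 22 ∷ affine 19 24 ∷
    affine 19 26 ∷ affine 19 27 ∷
    affine 20 0 ∷ affine 20 1 ∷ affine 20 2 ∷ affine 20 3 ∷ affine 20 4 ∷ affine 20 5 ∷
    affine 20 7 ∷ affine 20 8 ∷ affine 20 9 ∷ affine 20 11 ∷ affine 20 12 ∷ affine 20 13 ∷
    affine 20 15 ∷ affine 20 17 ∷ affine 20 18 ∷ affine 20 19 ∷ affine 20 21 ∷ affine 20 22 ∷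
    affine 20 24 ∷ affine 20 25 ∷ affine 20 26 ∷
    affine 21 0 ∷ affine 21 1 ∷ affine 21 4 ∷ affine 21 5 ∷ affine 21 6 ∷ affine 21 8 ∷
    affine 21 9 ∷ affine 21 10 ∷ affine 21 12 ∷ affine 21 14 ∷ affine 21 15 ∷ affine 21 17 ∷
    affine 21 18 ∷ affine 21 19 ∷ affine 21 20 ∷ affine 21 22 ∷ affine 21 23 ∷ affine 21 24 ∷
    affine 21 25 ∷ affine 21 26 ∷ affine 21 27 ∷ affine 21 28 ∷
    affine 22 0 ∷ affine 22 5 ∷ affine 22 9 ∷ affine 22 11 ∷ affine 22 12 ∷ affine 22 13 ∷
    affine 22 14 ∷ affine 22 15 ∷ affine 22 16 ∷ affine 22 17 ∷ affine 22 18 ∷ affine 22 19 ∷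
    affine 22 20 ∷ affine 22 22 ∷ affine 22 23 ∷ affine 22 24 ∷ affine 22 25 ∷ affine 22 26 ∷
    affine 22 28 ∷
    affine 23 0 ∷ affine 23 1 ∷ affine 23 2 ∷ affine 23 3 ∷ affine 23 4 ∷ affine 23 5 ∷
    affine 23 6 ∷ affine 23 8 ∷ affine 23 9 ∷ affine 23 11 ∷ affine 23 12 ∷ affine 23 15 ∷
    affine 23 16 ∷ affine 23 17 ∷ affine 23 19 ∷ affine 23 20 ∷ affine 23 25 ∷ affine 23 27 ∷
    affine 23 28 ∷
    affine 24 0 ∷ affine 24 1 ∷ affine 24 2 ∷ affine 24 3 ∷ affine 24 5 ∷ affine 24 6 ∷
    affine 24 7 ∷ affine 24 10 ∷ affine 24 11 ∷ affine 24 12 ∷ affine 24 15 ∷ affine 24 16 ∷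
    affine 24 17 ∷ affine 24 19 ∷ affine 24 20 ∷ affine 24 21 ∷ affine 24 23 ∷ affine 24 24 ∷
    affine 24 26 ∷ affine 24 27 ∷ affine 24 28 ∷
    affine 25 2 ∷ affine 25 3 ∷ affine 25 5 ∷ affine 25 6 ∷ affine 25 9 ∷ affine 25 10 ∷
    affine 25 11 ∷ affine 25 12 ∷ affine 25 13 ∷ affine 25 14 ∷ affine 25 15 ∷ affine 25 16 ∷
    affine 25 17 ∷ affine 25 19 ∷ affine 25 20 ∷ affine 25 21 ∷ affine 25 22 ∷ affine 25 24 ∷
    affine 25 25 ∷ affine 25 27 ∷ affine 25 28 ∷
    affine 26 0 ∷ affine 26 1 ∷ affine 26 2 ∷ affine 26 3 ∷ affine 26 4 ∷ affine 26 5 ∷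
    affine 26 6 ∷ affine 26 7 ∷ affine 26 8 ∷ affine 26 10 ∷ affine 26 11 ∷ affine 26 12 ∷
    affine 26 13 ∷ affine 26 15 ∷ affine 26 17 ∷ affine 26 19 ∷ affine 26 21 ∷ affine 26 25 ∷
    affine 26 26 ∷
    affine 27 1 ∷ affine 27 3 ∷ affine 27 5 ∷ affine 27 6 ∷ affine 27 7 ∷ affine 27 8 ∷
    affine 27 9 ∷ affine 27 10 ∷ affine 27 12 ∷ affine 27 13 ∷ affine 27 14 ∷ affine 27 16 ∷
    affine 27 17 ∷ affine 27 18 ∷ affine 27 19 ∷ affine 27 20 ∷ affine 27 21 ∷ affine 27 22 ∷
    affine 27 23 ∷ affine 27 25 ∷ affine 27 27 ∷ affine 27 28 ∷ []

  arc-595-22 : ArcExists 595 22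
  arc-595-22 = checkedArc points-595-22 22 ⟦ affine 0 4 ⟧ refl

  points-628-23 : List Rep
  points-628-23 =
    ideal∞ ∷
    ideal 0 ∷ ideal 2 ∷ ideal 4 ∷ ideal 5 ∷ ideal 6 ∷ ideal 8 ∷ ideal 9 ∷ ideal 10 ∷ ideal 12 ∷
    ideal 13 ∷ ideal 14 ∷ ideal 15 ∷ ideal 16 ∷ ideal 18 ∷ ideal 19 ∷ ideal 20 ∷ ideal 22 ∷
    ideal 23 ∷ ideal 24 ∷ ideal 25 ∷ ideal 28 ∷
    affine 0 0 ∷ affine 0 1 ∷ affine 0 2 ∷ affine 0 3 ∷ affine 0 4 ∷ affine 0 5 ∷ affine 0 7 ∷
    affine 0 8 ∷ affine 0 12 ∷ affine 0 14 ∷ affine 0 15 ∷ affine 0 16 ∷ affine 0 17 ∷ affine 0 18 ∷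
    affine 0 19 ∷ affine 0 20 ∷ affine 0 21 ∷ affine 0 22 ∷ affine 0 23 ∷ affine 0 25 ∷
    affine 0 26 ∷ affine 0 28 ∷
    affine 1 0 ∷ affine 1 1 ∷ affine 1 4 ∷ affine 1 5 ∷ affine 1 6 ∷ affine 1 7 ∷ affine 1 8 ∷
    affine 1 9 ∷ affine 1 11 ∷ affine 1 12 ∷ affine 1 13 ∷ affine 1 14 ∷ affine 1 15 ∷ affine 1 16 ∷
    affine 1 17 ∷ affine 1 18 ∷ affine 1 19 ∷ affine 1 21 ∷ affine 1 24 ∷ affine 1 25 ∷
    affine 1 26 ∷ affine 1 27 ∷
    affine 2 1 ∷ affine 2 2 ∷ affine 2 3 ∷ affine 2 6 ∷ affine 2 7 ∷ affine 2 8 ∷ affine 2 9 ∷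
    affine 2 10 ∷ affine 2 12 ∷ affine 2 13 ∷ affine 2 14 ∷ affine 2 16 ∷ affine 2 17 ∷
    affine 2 18 ∷ affine 2 19 ∷ affine 2 21 ∷ affine 2 22 ∷ affine 2 24 ∷ affine 2 25 ∷
    affine 2 26 ∷ affine 2 28 ∷
    affine 3 2 ∷ affine 3 3 ∷ affine 3 4 ∷ affine 3 6 ∷ affine 3 7 ∷ affine 3 8 ∷ affine 3 9 ∷
    affine 3 10 ∷ affine 3 11 ∷ affine 3 13 ∷ affine 3 14 ∷ affine 3 16 ∷ affine 3 17 ∷
    affine 3 19 ∷ affine 3 20 ∷ affine 3 21 ∷ affine 3 22 ∷ affine 3 23 ∷ affine 3 24 ∷
    affine 3 25 ∷ affine 3 27 ∷ affine 3 28 ∷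
    affine 4 1 ∷ affine 4 3 ∷ affine 4 4 ∷ affine 4 5 ∷ affine 4 6 ∷ affine 4 8 ∷ affine 4 9 ∷
    affine 4 10 ∷ affine 4 11 ∷ affine 4 14 ∷ affine 4 15 ∷ affine 4 17 ∷ affine 4 18 ∷
    affine 4 19 ∷ affine 4 20 ∷ affine 4 22 ∷ affine 4 24 ∷ affine 4 25 ∷ affine 4 27 ∷
    affine 4 28 ∷
    affine 5 0 ∷ affine 5 1 ∷ affine 5 2 ∷ affine 5 4 ∷ affine 5 5 ∷ affine 5 6 ∷ affine 5 7 ∷
    affine 5 10 ∷ affine 5 11 ∷ affine 5 12 ∷ affine 5 13 ∷ affine 5 15 ∷ affine 5 16 ∷
    affine 5 17 ∷ affine 5 18 ∷ affine 5 21 ∷ affine 5 22 ∷ affine 5 23 ∷ affine 5 24 ∷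
    affine 5 25 ∷ affine 5 26 ∷ affine 5 27 ∷
    affine 6 0 ∷ affine 6 1 ∷ affine 6 2 ∷ affine 6 3 ∷ affine 6 5 ∷ affine 6 7 ∷ affine 6 8 ∷
    affine 6 9 ∷ affine 6 10 ∷ affine 6 11 ∷ affine 6 13 ∷ affine 6 14 ∷ affine 6 16 ∷ affine 6 18 ∷
    affine 6 21 ∷ affine 6 22 ∷ affine 6 23 ∷ affine 6 24 ∷ affine 6 25 ∷ affine 6 28 ∷
    affine 7 0 ∷ affine 7 2 ∷ affine 7 6 ∷ affine 7 7 ∷ affine 7 8 ∷ affine 7 11 ∷ affine 7 13 ∷
    affine 7 15 ∷ affine 7 17 ∷ affine 7 18 ∷ affine 7 19 ∷ affine 7 20 ∷ affine 7 21 ∷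
    affine 7 22 ∷ affine 7 23 ∷ affine 7 24 ∷ affine 7 25 ∷ affine 7 26 ∷ affine 7 27 ∷
    affine 7 28 ∷
    affine 8 0 ∷ affine 8 1 ∷ affine 8 3 ∷ affine 8 5 ∷ affine 8 7 ∷ affine 8 9 ∷ affine 8 10 ∷
    affine 8 14 ∷ affine 8 15 ∷ affine 8 16 ∷ affine 8 18 ∷ affine 8 19 ∷ affine 8 20 ∷
    affine 8 21 ∷ affine 8 22 ∷ affine 8 23 ∷ affine 8 24 ∷ affine 8 26 ∷ affine 8 27 ∷
    affine 8 28 ∷
    affine 9 0 ∷ affine 9 1 ∷ affine 9 2 ∷ affine 9 3 ∷ affine 9 4 ∷ affine 9 5 ∷ affine 9 9 ∷
    affine 9 10 ∷ affine 9 11 ∷ affine 9 12 ∷ affine 9 13 ∷ affine 9 14 ∷ affine 9 16 ∷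
    affine 9 17 ∷ affine 9 20 ∷ affine 9 21 ∷ affine 9 22 ∷ affine 9 24 ∷ affine 9 26 ∷
    affine 9 27 ∷ affine 9 28 ∷
    affine 10 0 ∷ affine 10 1 ∷ affine 10 2 ∷ affine 10 3 ∷ affine 10 6 ∷ affine 10 7 ∷
    affine 10 9 ∷ affine 10 10 ∷ affine 10 11 ∷ affine 10 12 ∷ affine 10 13 ∷ affine 10 14 ∷
    affine 10 15 ∷ affine 10 16 ∷ affine 10 20 ∷ affine 10 21 ∷ affine 10 22 ∷ affine 10 23 ∷
    affine 10 24 ∷ affine 10 26 ∷ affine 10 27 ∷ affine 10 28 ∷
    affine 11 0 ∷ affine 11 1 ∷ affine 11 4 ∷ affine 11 5 ∷ affine 11 6 ∷ affine 11 7 ∷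
    affine 11 8 ∷ affine 11 10 ∷ affine 11 11 ∷ affine 11 12 ∷ affine 11 14 ∷ affine 11 15 ∷
    affine 11 18 ∷ affine 11 19 ∷ affine 11 22 ∷ affine 11 23 ∷ affine 11 24 ∷ affine 11 25 ∷
    affine 11 26 ∷ affine 11 27 ∷ affine 11 28 ∷
    affine 12 2 ∷ affine 12 3 ∷ affine 12 4 ∷ affine 12 5 ∷ affine 12 6 ∷ affine 12 7 ∷
    affine 12 8 ∷ affine 12 9 ∷ affine 12 11 ∷ affine 12 12 ∷ affine 12 13 ∷ affine 12 14 ∷
    affine 12 15 ∷ affine 12 16 ∷ affine 12 17 ∷ affine 12 18 ∷ affine 12 19 ∷ affine 12 20 ∷
    affine 12 22 ∷ affine 12 23 ∷ affine 12 25 ∷ affine 12 26 ∷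
    affine 13 0 ∷ affine 13 1 ∷ affine 13 2 ∷ affine 13 3 ∷ affine 13 4 ∷ affine 13 5 ∷
    affine 13 6 ∷ affine 13 7 ∷ affine 13 8 ∷ affine 13 10 ∷ affine 13 12 ∷ affine 13 14 ∷
    affine 13 15 ∷ affine 13 16 ∷ affine 13 18 ∷ affine 13 19 ∷ affine 13 20 ∷ affine 13 21 ∷
    affine 13 23 ∷ affine 13 24 ∷ affine 13 26 ∷ affine 13 28 ∷
    affine 14 0 ∷ affine 14 2 ∷ affine 14 3 ∷ affine 14 4 ∷ affine 14 5 ∷ affine 14 6 ∷
    affine 14 7 ∷ affine 14 8 ∷ affine 14 9 ∷ affine 14 10 ∷ affine 14 11 ∷ affine 14 13 ∷
    affine 14 15 ∷ affine 14 16 ∷ affine 14 17 ∷ affine 14 18 ∷ affine 14 19 ∷ affine 14 26 ∷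
    affine 14 27 ∷ affine 14 28 ∷
    affine 15 1 ∷ affine 15 3 ∷ affine 15 5 ∷ affine 15 7 ∷ affine 15 8 ∷ affine 15 9 ∷
    affine 15 10 ∷ affine 15 11 ∷ affine 15 12 ∷ affine 15 14 ∷ affine 15 15 ∷ affine 15 16 ∷
    affine 15 17 ∷ affine 15 18 ∷ affine 15 19 ∷ affine 15 20 ∷ affine 15 21 ∷ affine 15 22 ∷
    affine 15 25 ∷ affine 15 26 ∷ affine 15 27 ∷ affine 15 28 ∷
    affine 16 0 ∷ affine 16 1 ∷ affine 16 2 ∷ affine 16 3 ∷ affine 16 4 ∷ affine 16 5 ∷
    affine 16 6 ∷ affine 16 8 ∷ affine 16 10 ∷ affine 16 11 ∷ affine 16 12 ∷ affine 16 15 ∷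
    affine 16 17 ∷ affine 16 18 ∷ affine 16 19 ∷ affine 16 20 ∷ affine 16 23 ∷ affine 16 24 ∷
    affine 16 26 ∷ affine 16 28 ∷
    affine 17 0 ∷ affine 17 1 ∷ affine 17 2 ∷ affine 17 3 ∷ affine 17 4 ∷ affine 17 5 ∷
    affine 17 6 ∷ affine 17 7 ∷ affine 17 8 ∷ affine 17 9 ∷ affine 17 11 ∷ affine 17 12 ∷
    affine 17 14 ∷ affine 17 17 ∷ affine 17 18 ∷ affine 17 20 ∷ affine 17 21 ∷ affine 17 22 ∷
    affine 17 23 ∷ affine 17 25 ∷ affine 17 27 ∷ affine 17 28 ∷
    affine 18 0 ∷ affine 18 2 ∷ affine 18 3 ∷ affine 18 4 ∷ affine 18 7 ∷ affine 18 8 ∷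
    affine 18 9 ∷ affine 18 12 ∷ affine 18 14 ∷ affine 18 15 ∷ affine 18 18 ∷ affine 18 19 ∷
    affine 18 20 ∷ affine 18 21 ∷ affine 18 22 ∷ affine 18 24 ∷ affine 18 25 ∷ affine 18 26 ∷
    affine 18 28 ∷
    affine 19 0 ∷ affine 19 2 ∷ affine 19 4 ∷ affine 19 5 ∷ affine 19 6 ∷ affine 19 8 ∷
    affine 19 9 ∷ affine 19 10 ∷ affine 19 11 ∷ affine 19 12 ∷ affine 19 13 ∷ affine 19 14 ∷
    affine 19 18 ∷ affine 19 19 ∷ affine 19 20 ∷ affine 19 21 ∷ affine 19 22 ∷ affine 19 24 ∷
    affine 19 25 ∷ affine 19 26 ∷ affine 19 27 ∷
    affine 20 1 ∷ affine 20 2 ∷ affine 20 3 ∷ affine 20 5 ∷ affine 20 6 ∷ affine 20 7 ∷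
    affine 20 9 ∷ affine 20 10 ∷ affine 20 11 ∷ affine 20 12 ∷ affine 20 14 ∷ affine 20 17 ∷
    affine 20 20 ∷ affine 20 21 ∷ affine 20 22 ∷ affine 20 23 ∷ affine 20 25 ∷ affine 20 26 ∷
    affine 20 27 ∷
    affine 21 0 ∷ affine 21 2 ∷ affine 21 3 ∷ affine 21 4 ∷ affine 21 5 ∷ affine 21 7 ∷
    affine 21 8 ∷ affine 21 9 ∷ affine 21 12 ∷ affine 21 13 ∷ affine 21 14 ∷ affine 21 17 ∷
    affine 21 18 ∷ affine 21 20 ∷ affine 21 21 ∷ affine 21 23 ∷ affine 21 24 ∷ affine 21 25 ∷
    affine 21 26 ∷ affine 21 27 ∷ affine 21 28 ∷
    affine 22 0 ∷ affine 22 1 ∷ affine 22 3 ∷ affine 22 4 ∷ affine 22 5 ∷ affine 22 6 ∷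
    affine 22 7 ∷ affine 22 10 ∷ affine 22 11 ∷ affine 22 12 ∷ affine 22 13 ∷ affine 22 14 ∷
    affine 22 15 ∷ affine 22 16 ∷ affine 22 17 ∷ affine 22 18 ∷ affine 22 19 ∷ affine 22 23 ∷
    affine 22 24 ∷ affine 22 26 ∷ affine 22 28 ∷
    affine 23 1 ∷ affine 23 2 ∷ affine 23 4 ∷ affine 23 5 ∷ affine 23 6 ∷ affine 23 8 ∷
    affine 23 9 ∷ affine 23 10 ∷ affine 23 11 ∷ affine 23 12 ∷ affine 23 14 ∷ affine 23 15 ∷
    affine 23 17 ∷ affine 23 18 ∷ affine 23 19 ∷ affine 23 20 ∷ affine 23 22 ∷ affine 23 23 ∷
    affine 23 25 ∷ affine 23 26 ∷ affine 23 27 ∷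
    affine 24 0 ∷ affine 24 1 ∷ affine 24 3 ∷ affine 24 6 ∷ affine 24 8 ∷ affine 24 9 ∷
    affine 24 10 ∷ affine 24 11 ∷ affine 24 12 ∷ affine 24 13 ∷ affine 24 16 ∷ affine 24 17 ∷
    affine 24 18 ∷ affine 24 19 ∷ affine 24 20 ∷ affine 24 23 ∷ affine 24 24 ∷ affine 24 25 ∷
    affine 24 26 ∷ affine 24 27 ∷ affine 24 28 ∷
    affine 25 0 ∷ affine 25 1 ∷ affine 25 2 ∷ affine 25 4 ∷ affine 25 6 ∷ affine 25 7 ∷
    affine 25 8 ∷ affine 25 9 ∷ affine 25 10 ∷ affine 25 11 ∷ affine 25 12 ∷ affine 25 15 ∷
    affine 25 16 ∷ affine 25 17 ∷ affine 25 19 ∷ affine 25 20 ∷ affine 25 21 ∷ affine 25 22 ∷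
    affine 25 24 ∷ affine 25 27 ∷ affine 25 28 ∷
    affine 26 0 ∷ affine 26 2 ∷ affine 26 3 ∷ affine 26 4 ∷ affine 26 9 ∷ affine 26 10 ∷
    affine 26 11 ∷ affine 26 12 ∷ affine 26 13 ∷ affine 26 14 ∷ affine 26 16 ∷ affine 26 17 ∷
    affine 26 18 ∷ affine 26 19 ∷ affine 26 20 ∷ affine 26 22 ∷ affine 26 23 ∷ affine 26 25 ∷
    affine 26 26 ∷ affine 26 27 ∷ affine 26 28 ∷
    affine 27 0 ∷ affine 27 1 ∷ affine 27 2 ∷ affine 27 3 ∷ affine 27 4 ∷ affine 27 5 ∷
    affine 27 6 ∷ affine 27 8 ∷ affine 27 9 ∷ affine 27 10 ∷ affine 27 14 ∷ affine 27 15 ∷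
    affine 27 16 ∷ affine 27 17 ∷ affine 27 20 ∷ affine 27 21 ∷ affine 27 22 ∷ affine 27 23 ∷
    affine 27 24 ∷ affine 27 27 ∷
    affine 28 2 ∷ affine 28 3 ∷ affine 28 4 ∷ affine 28 5 ∷ affine 28 7 ∷ affine 28 10 ∷
    affine 28 11 ∷ affine 28 12 ∷ affine 28 13 ∷ affine 28 15 ∷ affine 28 16 ∷ affine 28 17 ∷
    affine 28 19 ∷ affine 28 20 ∷ affine 28 22 ∷ affine 28 23 ∷ affine 28 24 ∷ affine 28 25 ∷
    affine 28 27 ∷ affine 28 28 ∷ []

  arc-628-23 : ArcExists 628 23
  arc-628-23 = checkedArc points-628-23 23 ⟦ affine 0 1 ⟧ refl

  points-695-25 : List Rep
  points-695-25 =
    ideal 1 ∷ ideal 2 ∷ ideal 3 ∷ ideal 4 ∷ ideal 5 ∷ ideal 6 ∷ ideal 7 ∷ ideal 8 ∷ ideal 9 ∷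
    ideal 10 ∷ ideal 11 ∷ ideal 12 ∷ ideal 13 ∷ ideal 14 ∷ ideal 15 ∷ ideal 16 ∷ ideal 17 ∷
    ideal 18 ∷ ideal 19 ∷ ideal 20 ∷ ideal 23 ∷ ideal 24 ∷ ideal 25 ∷ ideal 27 ∷ ideal 28 ∷
    affine 0 1 ∷ affine 0 2 ∷ affine 0 4 ∷ affine 0 5 ∷ affine 0 6 ∷ affine 0 9 ∷ affine 0 10 ∷
    affine 0 11 ∷ affine 0 12 ∷ affine 0 13 ∷ affine 0 14 ∷ affine 0 15 ∷ affine 0 16 ∷
    affine 0 17 ∷ affine 0 18 ∷ affine 0 19 ∷ affine 0 20 ∷ affine 0 21 ∷ affine 0 22 ∷
    affine 0 23 ∷ affine 0 24 ∷ affine 0 25 ∷ affine 0 26 ∷ affine 0 27 ∷ affine 0 28 ∷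
    affine 1 1 ∷ affine 1 2 ∷ affine 1 3 ∷ affine 1 6 ∷ affine 1 7 ∷ affine 1 8 ∷ affine 1 9 ∷
    affine 1 10 ∷ affine 1 11 ∷ affine 1 12 ∷ affine 1 13 ∷ affine 1 14 ∷ affine 1 15 ∷
    affine 1 16 ∷ affine 1 17 ∷ affine 1 18 ∷ affine 1 19 ∷ affine 1 20 ∷ affine 1 21 ∷
    affine 1 22 ∷ affine 1 23 ∷ affine 1 26 ∷ affine 1 27 ∷ affine 1 28 ∷
    affine 2 3 ∷ affine 2 4 ∷ affine 2 5 ∷ affine 2 6 ∷ affine 2 7 ∷ affine 2 8 ∷ affine 2 9 ∷
    affine 2 10 ∷ affine 2 11 ∷ affine 2 12 ∷ affine 2 13 ∷ affine 2 14 ∷ affine 2 15 ∷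
    affine 2 17 ∷ affine 2 19 ∷ affine 2 20 ∷ affine 2 22 ∷ affine 2 23 ∷ affine 2 24 ∷
    affine 2 25 ∷ affine 2 26 ∷ affine 2 27 ∷ affine 2 28 ∷
    affine 3 1 ∷ affine 3 2 ∷ affine 3 3 ∷ affine 3 4 ∷ affine 3 5 ∷ affine 3 6 ∷ affine 3 7 ∷
    affine 3 9 ∷ affine 3 10 ∷ affine 3 12 ∷ affine 3 14 ∷ affine 3 15 ∷ affine 3 16 ∷ affine 3 17 ∷
    affine 3 18 ∷ affine 3 19 ∷ affine 3 20 ∷ affine 3 21 ∷ affine 3 22 ∷ affine 3 23 ∷
    affine 3 24 ∷ affine 3 26 ∷
    affine 4 1 ∷ affine 4 2 ∷ affine 4 3 ∷ affine 4 6 ∷ affine 4 7 ∷ affine 4 8 ∷ affine 4 9 ∷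
    affine 4 10 ∷ affine 4 11 ∷ affine 4 12 ∷ affine 4 13 ∷ affine 4 14 ∷ affine 4 15 ∷
    affine 4 16 ∷ affine 4 17 ∷ affine 4 18 ∷ affine 4 19 ∷ affine 4 20 ∷ affine 4 21 ∷
    affine 4 22 ∷ affine 4 23 ∷ affine 4 26 ∷ affine 4 27 ∷ affine 4 28 ∷
    affine 5 1 ∷ affine 5 2 ∷ affine 5 3 ∷ affine 5 4 ∷ affine 5 5 ∷ affine 5 6 ∷ affine 5 7 ∷
    affine 5 8 ∷ affine 5 9 ∷ affine 5 10 ∷ affine 5 11 ∷ affine 5 12 ∷ affine 5 13 ∷ affine 5 14 ∷
    affine 5 15 ∷ affine 5 16 ∷ affine 5 17 ∷ affine 5 18 ∷ affine 5 19 ∷ affine 5 20 ∷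
    affine 5 23 ∷ affine 5 24 ∷ affine 5 25 ∷ affine 5 27 ∷ affine 5 28 ∷
    affine 6 1 ∷ affine 6 2 ∷ affine 6 3 ∷ affine 6 4 ∷ affine 6 5 ∷ affine 6 6 ∷ affine 6 7 ∷
    affine 6 8 ∷ affine 6 9 ∷ affine 6 10 ∷ affine 6 11 ∷ affine 6 12 ∷ affine 6 14 ∷ affine 6 15 ∷
    affine 6 16 ∷ affine 6 17 ∷ affine 6 20 ∷ affine 6 21 ∷ affine 6 22 ∷ affine 6 23 ∷
    affine 6 24 ∷ affine 6 25 ∷ affine 6 26 ∷ affine 6 27 ∷ affine 6 28 ∷
    affine 7 1 ∷ affine 7 2 ∷ affine 7 3 ∷ affine 7 4 ∷ affine 7 6 ∷ affine 7 7 ∷ affine 7 8 ∷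
    affine 7 9 ∷ affine 7 11 ∷ affine 7 13 ∷ affine 7 14 ∷ affine 7 17 ∷ affine 7 18 ∷ affine 7 19 ∷
    affine 7 20 ∷ affine 7 21 ∷ affine 7 22 ∷ affine 7 23 ∷ affine 7 24 ∷ affine 7 25 ∷
    affine 7 26 ∷ affine 7 27 ∷ affine 7 28 ∷
    affine 8 1 ∷ affine 8 3 ∷ affine 8 4 ∷ affine 8 6 ∷ affine 8 7 ∷ affine 8 8 ∷ affine 8 9 ∷
    affine 8 10 ∷ affine 8 11 ∷ affine 8 14 ∷ affine 8 15 ∷ affine 8 16 ∷ affine 8 17 ∷
    affine 8 18 ∷ affine 8 19 ∷ affine 8 20 ∷ affine 8 21 ∷ affine 8 22 ∷ affine 8 23 ∷
    affine 8 24 ∷ affine 8 25 ∷ affine 8 27 ∷ affine 8 28 ∷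
    affine 9 1 ∷ affine 9 2 ∷ affine 9 3 ∷ affine 9 4 ∷ affine 9 5 ∷ affine 9 6 ∷ affine 9 7 ∷
    affine 9 8 ∷ affine 9 11 ∷ affine 9 12 ∷ affine 9 13 ∷ affine 9 14 ∷ affine 9 15 ∷ affine 9 16 ∷
    affine 9 17 ∷ affine 9 19 ∷ affine 9 20 ∷ affine 9 21 ∷ affine 9 22 ∷ affine 9 24 ∷
    affine 9 25 ∷ affine 9 26 ∷ affine 9 28 ∷
    affine 10 1 ∷ affine 10 2 ∷ affine 10 3 ∷ affine 10 4 ∷ affine 10 5 ∷ affine 10 8 ∷
    affine 10 9 ∷ affine 10 11 ∷ affine 10 12 ∷ affine 10 13 ∷ affine 10 14 ∷ affine 10 16 ∷
    affine 10 17 ∷ affine 10 18 ∷ affine 10 19 ∷ affine 10 21 ∷ affine 10 22 ∷ affine 10 23 ∷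
    affine 10 24 ∷ affine 10 25 ∷ affine 10 26 ∷ affine 10 27 ∷ affine 10 28 ∷
    affine 11 1 ∷ affine 11 5 ∷ affine 11 6 ∷ affine 11 9 ∷ affine 11 10 ∷ affine 11 11 ∷
    affine 11 12 ∷ affine 11 14 ∷ affine 11 15 ∷ affine 11 16 ∷ affine 11 17 ∷ affine 11 18 ∷
    affine 11 19 ∷ affine 11 20 ∷ affine 11 21 ∷ affine 11 22 ∷ affine 11 23 ∷ affine 11 24 ∷
    affine 11 25 ∷ affine 11 26 ∷ affine 11 27 ∷ affine 11 28 ∷
    affine 12 2 ∷ affine 12 3 ∷ affine 12 4 ∷ affine 12 5 ∷ affine 12 7 ∷ affine 12 8 ∷
    affine 12 9 ∷ affine 12 10 ∷ affine 12 11 ∷ affine 12 12 ∷ affine 12 13 ∷ affine 12 14 ∷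
    affine 12 15 ∷ affine 12 16 ∷ affine 12 17 ∷ affine 12 18 ∷ affine 12 19 ∷ affine 12 20 ∷
    affine 12 21 ∷ affine 12 22 ∷ affine 12 24 ∷ affine 12 25 ∷ affine 12 26 ∷ affine 12 27 ∷
    affine 13 1 ∷ affine 13 2 ∷ affine 13 3 ∷ affine 13 4 ∷ affine 13 5 ∷ affine 13 6 ∷
    affine 13 7 ∷ affine 13 8 ∷ affine 13 9 ∷ affine 13 10 ∷ affine 13 11 ∷ affine 13 12 ∷
    affine 13 13 ∷ affine 13 14 ∷ affine 13 16 ∷ affine 13 17 ∷ affine 13 18 ∷ affine 13 19 ∷
    affine 13 22 ∷ affine 13 23 ∷ affine 13 24 ∷ affine 13 25 ∷
    affine 14 1 ∷ affine 14 2 ∷ affine 14 3 ∷ affine 14 4 ∷ affine 14 5 ∷ affine 14 6 ∷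
    affine 14 8 ∷ affine 14 9 ∷ affine 14 10 ∷ affine 14 11 ∷ affine 14 13 ∷ affine 14 14 ∷
    affine 14 15 ∷ affine 14 16 ∷ affine 14 17 ∷ affine 14 18 ∷ affine 14 19 ∷ affine 14 20 ∷
    affine 14 22 ∷ affine 14 25 ∷ affine 14 26 ∷ affine 14 27 ∷ affine 14 28 ∷
    affine 15 1 ∷ affine 15 2 ∷ affine 15 3 ∷ affine 15 5 ∷ affine 15 6 ∷ affine 15 7 ∷
    affine 15 8 ∷ affine 15 9 ∷ affine 15 10 ∷ affine 15 11 ∷ affine 15 12 ∷ affine 15 13 ∷
    affine 15 15 ∷ affine 15 16 ∷ affine 15 17 ∷ affine 15 18 ∷ affine 15 19 ∷ affine 15 22 ∷
    affine 15 23 ∷ affine 15 24 ∷ affine 15 25 ∷ affine 15 26 ∷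
    affine 16 1 ∷ affine 16 2 ∷ affine 16 3 ∷ affine 16 4 ∷ affine 16 5 ∷ affine 16 6 ∷
    affine 16 8 ∷ affine 16 9 ∷ affine 16 10 ∷ affine 16 11 ∷ affine 16 12 ∷ affine 16 13 ∷
    affine 16 14 ∷ affine 16 15 ∷ affine 16 16 ∷ affine 16 19 ∷ affine 16 21 ∷ affine 16 22 ∷
    affine 16 23 ∷ affine 16 24 ∷ affine 16 26 ∷ affine 16 27 ∷ affine 16 28 ∷
    affine 17 1 ∷ affine 17 2 ∷ affine 17 3 ∷ affine 17 4 ∷ affine 17 5 ∷ affine 17 6 ∷
    affine 17 7 ∷ affine 17 8 ∷ affine 17 9 ∷ affine 17 10 ∷ affine 17 11 ∷ affine 17 13 ∷
    affine 17 16 ∷ affine 17 18 ∷ affine 17 19 ∷ affine 17 20 ∷ affine 17 21 ∷ affine 17 22 ∷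
    affine 17 23 ∷ affine 17 24 ∷ affine 17 25 ∷ affine 17 26 ∷ affine 17 27 ∷ affine 17 28 ∷
    affine 18 2 ∷ affine 18 3 ∷ affine 18 5 ∷ affine 18 6 ∷ affine 18 7 ∷ affine 18 8 ∷
    affine 18 10 ∷ affine 18 13 ∷ affine 18 14 ∷ affine 18 15 ∷ affine 18 16 ∷ affine 18 17 ∷
    affine 18 18 ∷ affine 18 19 ∷ affine 18 20 ∷ affine 18 21 ∷ affine 18 23 ∷ affine 18 24 ∷
    affine 18 25 ∷ affine 18 26 ∷ affine 18 27 ∷ affine 18 28 ∷
    affine 19 2 ∷ affine 19 3 ∷ affine 19 4 ∷ affine 19 5 ∷ affine 19 6 ∷ affine 19 7 ∷
    affine 19 10 ∷ affine 19 11 ∷ affine 19 12 ∷ affine 19 13 ∷ affine 19 14 ∷ affine 19 16 ∷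
    affine 19 17 ∷ affine 19 18 ∷ affine 19 19 ∷ affine 19 20 ∷ affine 19 21 ∷ affine 19 22 ∷
    affine 19 23 ∷ affine 19 24 ∷ affine 19 26 ∷ affine 19 27 ∷ affine 19 28 ∷
    affine 20 1 ∷ affine 20 2 ∷ affine 20 3 ∷ affine 20 4 ∷ affine 20 7 ∷ affine 20 9 ∷
    affine 20 10 ∷ affine 20 11 ∷ affine 20 12 ∷ affine 20 13 ∷ affine 20 14 ∷ affine 20 15 ∷
    affine 20 16 ∷ affine 20 18 ∷ affine 20 19 ∷ affine 20 21 ∷ affine 20 23 ∷ affine 20 24 ∷
    affine 20 25 ∷ affine 20 26 ∷ affine 20 27 ∷ affine 20 28 ∷
    affine 21 4 ∷ affine 21 5 ∷ affine 21 6 ∷ affine 21 7 ∷ affine 21 8 ∷ affine 21 10 ∷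
    affine 21 11 ∷ affine 21 12 ∷ affine 21 13 ∷ affine 21 15 ∷ affine 21 16 ∷ affine 21 17 ∷
    affine 21 18 ∷ affine 21 19 ∷ affine 21 20 ∷ affine 21 21 ∷ affine 21 22 ∷ affine 21 23 ∷
    affine 21 24 ∷ affine 21 25 ∷ affine 21 26 ∷ affine 21 27 ∷ affine 21 28 ∷
    affine 22 2 ∷ affine 22 3 ∷ affine 22 4 ∷ affine 22 5 ∷ affine 22 7 ∷ affine 22 8 ∷
    affine 22 9 ∷ affine 22 10 ∷ affine 22 11 ∷ affine 22 12 ∷ affine 22 13 ∷ affine 22 14 ∷
    affine 22 15 ∷ affine 22 16 ∷ affine 22 17 ∷ affine 22 18 ∷ affine 22 19 ∷ affine 22 20 ∷
    affine 22 21 ∷ affine 22 22 ∷ affine 22 24 ∷ affine 22 25 ∷ affine 22 26 ∷ affine 22 27 ∷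
    affine 23 1 ∷ affine 23 2 ∷ affine 23 3 ∷ affine 23 4 ∷ affine 23 5 ∷ affine 23 6 ∷
    affine 23 7 ∷ affine 23 8 ∷ affine 23 9 ∷ affine 23 10 ∷ affine 23 11 ∷ affine 23 12 ∷
    affine 23 13 ∷ affine 23 14 ∷ affine 23 15 ∷ affine 23 17 ∷ affine 23 18 ∷ affine 23 19 ∷
    affine 23 20 ∷ affine 23 21 ∷ affine 23 23 ∷ affine 23 24 ∷ affine 23 28 ∷
    affine 24 1 ∷ affine 24 2 ∷ affine 24 3 ∷ affine 24 4 ∷ affine 24 5 ∷ affine 24 6 ∷
    affine 24 7 ∷ affine 24 8 ∷ affine 24 10 ∷ affine 24 11 ∷ affine 24 12 ∷ affine 24 13 ∷
    affine 24 15 ∷ affine 24 16 ∷ affine 24 17 ∷ affine 24 20 ∷ affine 24 21 ∷ affine 24 24 ∷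
    affine 24 25 ∷ affine 24 26 ∷ affine 24 27 ∷ affine 24 28 ∷
    affine 25 1 ∷ affine 25 3 ∷ affine 25 4 ∷ affine 25 5 ∷ affine 25 7 ∷ affine 25 8 ∷
    affine 25 9 ∷ affine 25 10 ∷ affine 25 12 ∷ affine 25 13 ∷ affine 25 14 ∷ affine 25 16 ∷
    affine 25 17 ∷ affine 25 18 ∷ affine 25 21 ∷ affine 25 22 ∷ affine 25 23 ∷ affine 25 24 ∷
    affine 25 25 ∷ affine 25 26 ∷ affine 25 27 ∷ affine 25 28 ∷
    affine 26 1 ∷ affine 26 2 ∷ affine 26 4 ∷ affine 26 5 ∷ affine 26 7 ∷ affine 26 8 ∷
    affine 26 9 ∷ affine 26 10 ∷ affine 26 11 ∷ affine 26 12 ∷ affine 26 13 ∷ affine 26 14 ∷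
    affine 26 15 ∷ affine 26 18 ∷ affine 26 19 ∷ affine 26 20 ∷ affine 26 21 ∷ affine 26 22 ∷
    affine 26 23 ∷ affine 26 25 ∷ affine 26 26 ∷ affine 26 28 ∷
    affine 27 1 ∷ affine 27 2 ∷ affine 27 3 ∷ affine 27 4 ∷ affine 27 5 ∷ affine 27 6 ∷
    affine 27 7 ∷ affine 27 8 ∷ affine 27 9 ∷ affine 27 10 ∷ affine 27 11 ∷ affine 27 12 ∷
    affine 27 15 ∷ affine 27 16 ∷ affine 27 20 ∷ affine 27 21 ∷ affine 27 22 ∷ affine 27 23 ∷
    affine 27 25 ∷ affine 27 26 ∷ affine 27 27 ∷ affine 27 28 ∷
    affine 28 1 ∷ affine 28 2 ∷ affine 28 3 ∷ affine 28 4 ∷ affine 28 5 ∷ affine 28 6 ∷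
    affine 28 7 ∷ affine 28 8 ∷ affine 28 9 ∷ affine 28 12 ∷ affine 28 13 ∷ affine 28 14 ∷
    affine 28 15 ∷ affine 28 17 ∷ affine 28 18 ∷ affine 28 19 ∷ affine 28 20 ∷ affine 28 21 ∷
    affine 28 22 ∷ affine 28 23 ∷ affine 28 24 ∷ affine 28 25 ∷ affine 28 26 ∷ affine 28 27 ∷
    affine 28 28 ∷ []

  arc-695-25 : ArcExists 695 25
  arc-695-25 = checkedArc points-695-25 25 ⟦ affine 0 0 ⟧ refl

open PG[2,29] using (arc-507-19; arc-534-20; arc-565-21; arc-595-22; arc-628-23; arc-695-25)

mainTheorem7 : let open GF 29 in
    (ArcExists 507 19 × ArcExists 534 20 × ArcExists 565 21
    × ArcExists 595 22 × ArcExists 628 23 × ArcExists 695 25)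
    × (m≥ 19 507 × m≥ 20 534 × m≥ 21 565
    × m≥ 22 595 × m≥ 23 628 × m≥ 25 695)
mainTheorem7 =
    (arc-507-19 , arc-534-20 , arc-565-21 , arc-595-22 , arc-628-23 , arc-695-25)
  , (arc⇒m≥ arc-507-19 , arc⇒m≥ arc-534-20 , arc⇒m≥ arc-565-21
  , arc⇒m≥ arc-595-22 , arc⇒m≥ arc-628-23 , arc⇒m≥ arc-695-25)
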